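{- Let $\phi$ be an MSO formula over the signature $\{=\}\cup R_2$ with quantifier rank $m$. Suppose that $\phi$ has a model with clique-width at most $k$ and with $x>2^{|T^{[k]}_m|}$ vertices. Then there exist three clique-decompositions $\Gamma=\{\mathcal C_s,\mathcal C_r,\mathcal C_e\}$ of width at most $k$, with $\mathcal C_s,\mathcal C_r$ marked, such that: for every $\ell\in\mathbb N$, $\Delta^\Gamma(s\,r^\ell\,e)\models\phi$; $|\mathcal C_s\triangleright\mathcal C_e|=x$; and $\mathcal C_r$ is not empty (contains at least one constant node).
   Context: $R_2$ is a finite set of binary relation symbols; an $R_2$-graph is $G=(V,E)$ with $E\subseteq R_2\times V\times V$. For a finite color set $C$, a $C$-colored $R_2$-graph also has $\mathsf{Col}:V\to C$. Clique-decompositions are binary trees built from: $\mathsf{constant}^{\mathcal R}_c(v)$ (single vertex $v$ of color $c$ with loops $(r,v,v)$, $r\in\mathcal R\subseteq R_2$), $\mathsf{recolor}_f(H)$ ($f:C\to C$, new coloring $f\circ\mathsf{Col}_H$), and $\mathsf{join}_M(H,H')$ ($M\subseteq R_2\times\{\mathsf{left},\mathsf{right}\}\times C^2$: disjoint union plus, for $u\in V(H)$, $v\in V(H')$ with colors $c_u,c_v$, arc $(r,u,v)$ iff $(r,\mathsf{right},c_u,c_v)\in M$ and arc $(r,v,u)$ iff $(r,\mathsf{left},c_v,c_u)\in M$). The width of a decomposition is the number of colors used by some vertex at some node; the clique-width of a graph is the minimum width of a decomposition constructing it (up to forgetting colors). A decomposition is identified with the graph it constructs; $|\mathcal C|$ is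 its number of vertices (constant leaves), and $\mathcal C\models\phi$ means its graph satisfies $\phi$. A marked clique-decomposition has exactly one special leaf labelled $\square$ (a placeholder, not a vertex). Gluing $\mathcal C\triangleright\mathcal C'$ (for $\mathcal C$ marked) replaces the $\square$ leaf of $\mathcal C$ by $\mathcal C'$. For a family $\Gamma=\{\mathcal C_i\}_{i\in I}$ and a nonempty word $w=w_1\cdots w_n\in I^n$, $\Delta^\Gamma(w_1)=\mathcal C_{w_1}$ and $\Delta^\Gamma(w_1\cdots w_n)=\Delta^\Gamma(w_1\cdots w_{n-1})\triangleright\mathcal C_{w_n}$. The quantifier-rank-$m$ MSO type of a $C$-colored graph is the set of MSO formulae of quantifier rank at most $m$ (over $\{=\}\cup R_2$ plus the colors as unary predicates) it satisfies; $T^{[k]}_m$ is the (finite) set of such types for $[k]$-colored graphs, $[k]$ a set of $k$ colors. -}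

module Defs where

open import Data.Nat using (ℕ; zero; suc; _+_; _≤_; _<_; _^_)
open import Data.Fin using (Fin; zero; suc; splitAt; _≟_)
open import Data.Bool using (Bool; true; false; _∧_; _∨_; not; if_then_else_)
open import Data.Sum using (inj₁; inj₂)
open import Data.Product using (Σ; _×_; _,_)
open import Data.List using (List; []; _∷_; foldl)
open import Relation.Nullary using (¬_)
open import Relation.Nullary.Decidable using (⌊_⌋)
open import Relation.Binary.PropositionalEquality using (_≡_)
open import Function using (_∘_)
open import Function.Bundles using (_↔_; Inverse)

anyFin : (n : ℕ) → (Fin n → Bool) → Bool
anyFin zero    p = false
anyFin (suc n) p = p zero ∨ anyFin n (p ∘ suc)

countFin : (n : ℕ) → (Fin n → Bool) → ℕ
countFin zero    p = 0
countFin (suc n) p = (if p zero then 1 else 0) + countFin n (p ∘ suc)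

cons : {A : Set} {n : ℕ} → A → (Fin n → A) → Fin (suc n) → A
cons a f zero    = a
cons a f (suc i) = f i

anySubset : (n : ℕ) → ((Fin n → Bool) → Bool) → Bool
anySubset zero    p = p (λ ())
anySubset (suc n) p =
  anySubset n (λ S → p (cons true S)) ∨ anySubset n (λ S → p (cons false S))

-- R₂ = Fin nR.  Graphs: vertex set Fin vert, arcs given by a Boolean
-- relation for each binary relation symbol.

record Graph (nR : ℕ) : Set where
  field
    vert : ℕ
    edge : Fin nR → Fin vert → Fin vert → Bool
open Graph public

record CGraph (nR k : ℕ) : Set where
  field
    graph  : Graph nR
    colour : Fin (vert graph) → Fin k
open CGraph public

Iso : {nR : ℕ} → Graph nR → Graph nR → Set
Iso G H = Σ (Fin (vert G) ↔ Fin (vert H)) λ f →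
  ∀ r u v → edge H r (Inverse.to f u) (Inverse.to f v) ≡ edge G r u v

-- MSO formulae over {=} ∪ R₂ plus c unary (colour) predicates,
-- with f free first-order and s free set variables (de Bruijn).

data Formula (nR c f s : ℕ) : Set where
  eq   : Fin f → Fin f → Formula nR c f s
  rel  : Fin nR → Fin f → Fin f → Formula nR c f s
  col  : Fin c → Fin f → Formula nR c f s
  mem  : Fin f → Fin s → Formula nR c f s
  neg  : Formula nR c f s → Formula nR c f s
  and  : Formula nR c f s → Formula nR c f s → Formula nR c f s
  ex1  : Formula nR c (suc f) s → Formula nR c f s
  ex2  : Formula nR c f (suc s) → Formula nR c f s

qr : {nR c f s : ℕ} → Formula nR c f s → ℕ
qr (eq x y)    = 0
qr (rel r x y) = 0
qr (col a x)   = 0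
qr (mem x X)   = 0
qr (neg ψ)     = qr ψ
qr (and ψ χ)   = qr ψ Data.Nat.⊔ qr χ
qr (ex1 ψ)     = suc (qr ψ)
qr (ex2 ψ)     = suc (qr ψ)

sat : {nR c f s : ℕ} → Formula nR c f s →
      (G : Graph nR) → (Fin c → Fin (vert G) → Bool) →
      (Fin f → Fin (vert G)) → (Fin s → Fin (vert G) → Bool) → Bool
sat (eq x y)    G P ρ σ = ⌊ ρ x ≟ ρ y ⌋
sat (rel r x y) G P ρ σ = edge G r (ρ x) (ρ y)
sat (col a x)   G P ρ σ = P a (ρ x)
sat (mem x X)   G P ρ σ = σ X (ρ x)
sat (neg ψ)     G P ρ σ = not (sat ψ G P ρ σ)
sat (and ψ χ)   G P ρ σ = sat ψ G P ρ σ ∧ sat χ G P ρ σ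
sat (ex1 ψ)     G P ρ σ = anyFin (vert G) (λ v → sat ψ G P (cons v ρ) σ)
sat (ex2 ψ)     G P ρ σ = anySubset (vert G) (λ S → sat ψ G P ρ (cons S σ))

_⊨_ : {nR : ℕ} → Graph nR → Formula nR 0 0 0 → Set
G ⊨ φ = sat φ G (λ ()) (λ ()) (λ ()) ≡ true

satC : {nR k : ℕ} → CGraph nR k → Formula nR k 0 0 → Bool
satC G ψ = sat ψ (graph G) (λ a v → ⌊ colour G v ≟ a ⌋) (λ ()) (λ ())

SameType : {nR k : ℕ} → ℕ → CGraph nR k → CGraph nR k → Set
SameType {nR} {k} m G H =
  (ψ : Formula nR k 0 0) → qr ψ ≤ m → satC G ψ ≡ satC H ψ

-- |T^[k]_m| = N : there are exactly N quantifier-rank-m types of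
-- [k]-coloured R₂-graphs (N pairwise distinct realised types, and
-- every [k]-coloured graph has one of them).
IsTypeCount : ℕ → ℕ → ℕ → ℕ → Set
IsTypeCount nR k m N =
  Σ (Fin N → CGraph nR k) λ rep →
    ((i j : Fin N) → SameType m (rep i) (rep j) → i ≡ j) ×
    ((G : CGraph nR k) → Σ (Fin N) λ i → SameType m G (rep i))

-- Clique-decompositions with colour set Fin c (possibly with □ leaves)

data Side : Set where
  left right : Side

data CD (nR c : ℕ) : Set where
  constant : Fin c → (Fin nR → Bool) → CD nR c
  hole     : CD nR c
  recolor  : (Fin c → Fin c) → CD nR c → CD nR c
  join     : (Fin nR → Side → Fin c → Fin c → Bool) → CD nR c → CD nR c → CD nR c

∣_∣ : {nR c : ℕ} → CD nR c → ℕ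
∣ constant a R ∣ = 1
∣ hole ∣         = 0
∣ recolor g D ∣  = ∣ D ∣
∣ join M D E ∣   = ∣ D ∣ + ∣ E ∣

holes : {nR c : ℕ} → CD nR c → ℕ
holes (constant a R) = 0
holes hole           = 1
holes (recolor g D)  = holes D
holes (join M D E)   = holes D + holes E

colOf : {nR c : ℕ} (D : CD nR c) → Fin ∣ D ∣ → Fin c
colOf (constant a R) _ = a
colOf hole ()
colOf (recolor g D) i = g (colOf D i)
colOf (join M D E) i with splitAt ∣ D ∣ i
... | inj₁ a = colOf D a
... | inj₂ b = colOf E b

edgeOf : {nR c : ℕ} (D : CD nR c) → Fin nR → Fin ∣ D ∣ → Fin ∣ D ∣ → Bool
edgeOf (constant a R) r _ _ = R r
edgeOf hole r ()
edgeOf (recolor g D) r u v = edgeOf D r u v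
edgeOf (join M D E) r u v with splitAt ∣ D ∣ u | splitAt ∣ D ∣ v
... | inj₁ a | inj₁ b = edgeOf D r a b
... | inj₂ a | inj₂ b = edgeOf E r a b
... | inj₁ a | inj₂ b = M r right (colOf D a) (colOf E b)
... | inj₂ a | inj₁ b = M r left (colOf E a) (colOf D b)

graphOf : {nR c : ℕ} → CD nR c → Graph nR
graphOf D = record { vert = ∣ D ∣ ; edge = edgeOf D }

present : {nR c : ℕ} → CD nR c → Fin c → Bool
present D b = anyFin ∣ D ∣ (λ i → ⌊ colOf D i ≟ b ⌋)

usedColour : {nR c : ℕ} → CD nR c → Fin c → Bool
usedColour (constant a R) b = present (constant a R) b
usedColour hole b           = false
usedColour (recolor g D) b  = present (recolor g D) b ∨ usedColour D b
usedColour (join M D E) b   =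
  present (join M D E) b ∨ usedColour D b ∨ usedColour E b

width : {nR c : ℕ} → CD nR c → ℕ
width {c = c} D = countFin c (usedColour D)

_▷_ : {nR c : ℕ} → CD nR c → CD nR c → CD nR c
constant a R ▷ C' = constant a R
hole ▷ C'         = C'
recolor g D ▷ C'  = recolor g (D ▷ C')
join M D E ▷ C'   = join M (D ▷ C') (E ▷ C')

-- Δ^Γ(w₁ w₂ ⋯ wₙ) for the nonempty word w₁ ∷ (w₂ ⋯ wₙ)
Δ : {nR c : ℕ} {I : Set} → (I → CD nR c) → I → List I → CD nR c
Δ Γ w₁ ws = foldl (λ X i → X ▷ Γ i) (Γ w₁) ws

CliqueWidth≤ : {nR : ℕ} → ℕ → Graph nR → Set
CliqueWidth≤ {nR} k G =
  Σ ℕ λ c → Σ (CD nR c) λ D → holes D ≡ 0 × width D ≤ k × Iso (graphOf D) G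

data SRE : Set where
  s r e : SRE

family : {nR c : ℕ} → CD nR c → CD nR c → CD nR c → SRE → CD nR c
family Cs Cr Ce s = Cs
family Cs Cr Ce r = Cr
family Cs Cr Ce e = Ce

-- A decomposition of width k with more than 2^N vertices contains a chain
-- D = C₁ ▷ ⋯ ▷ C_N ▷ B of nonempty one-hole contexts. With the colours of D
-- renamed injectively into [k], the N + 1 suffixes Uᵢ = Cᵢ ▷ ⋯ ▷ C_N ▷ B realise
-- at most N rank-m types, so two of them agree: Uᵢ = Cr ▷ Uⱼ has the type of Uⱼ.
-- Rank-m types are compatible with recolouring, join and gluing (proved with
-- Ehrenfeucht–Fraïssé games, which Hintikka formulas tie to types), hence
-- Cr ▷ ⋯ ▷ Cr ▷ Uⱼ has the type of Uⱼ, and every pumped decomposition has the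
-- type of D, which satisfies φ.

module Submission where

open import Defs
open import Data.Nat using (ℕ; zero; suc; _+_; _*_; _⊔_; _≤_; _<_; _^_; z≤n; s≤s; _<?_; _≤?_)
open import Data.Nat.Properties hiding (_≟_)
open import Data.Fin using (Fin; zero; suc; toℕ; fromℕ<; splitAt; _↑ˡ_; _↑ʳ_; _≟_)
open import Data.Fin.Properties
  using (splitAt-↑ˡ; splitAt-↑ʳ; splitAt⁻¹-↑ˡ; splitAt⁻¹-↑ʳ; join-splitAt; fromℕ<-injective; pigeonhole; toℕ<n)
open import Data.Bool using (Bool; true; false; _∧_; _∨_; not; if_then_else_)
open import Data.Maybe using (Maybe; just; nothing)
import Data.Maybe as Maybe
open import Data.Sum using (_⊎_; inj₁; inj₂; [_,_]′)
open import Data.Sum.Properties using (inj₁-injective; inj₂-injective; [,]-∘)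
open import Data.Product using (Σ; _×_; _,_; proj₁; proj₂)
open import Data.List using (List; []; _∷_; _++_; replicate; foldr; foldl; length; take; drop)
open import Data.List.Properties using (foldr-++; take++drop≡id; drop-drop; length-drop)
open import Data.List.Relation.Unary.All using (All; []; _∷_)
import Data.List.Relation.Unary.All as All
open import Data.List.Relation.Unary.All.Properties using (take⁺; drop⁺)
open import Data.Unit using (⊤; tt)
open import Data.Empty using (⊥; ⊥-elim)
open import Function using (_∘_)
open import Function.Bundles using (_↔_; Inverse)
open import Data.Fin.Permutation using (↔⇒≡)
open import Relation.Nullary using (¬_; yes; no)
open import Relation.Nullary.Decidable using (⌊_⌋)
open import Relation.Binary.PropositionalEquality
  using (_≡_; _≢_; _≗_; refl; sym; trans; cong; cong₂; subst; subst₂; module ≡-Reasoning)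

private
  variable
    nR c c' m n nf nf' ns : ℕ

true-iff⇒≡ : {a b : Bool} → (a ≡ true → b ≡ true) → (b ≡ true → a ≡ true) → a ≡ b
true-iff⇒≡ {false} {false} _ _ = refl
true-iff⇒≡ {false} {true}  _ g = g refl
true-iff⇒≡ {true}  {false} f _ = sym (f refl)
true-iff⇒≡ {true}  {true}  _ _ = refl

∧-true⁻ : {a b : Bool} → a ∧ b ≡ true → a ≡ true × b ≡ true
∧-true⁻ {true} {true} _ = refl , refl

∧-true⁺ : {a b : Bool} → a ≡ true → b ≡ true → a ∧ b ≡ true
∧-true⁺ refl refl = refl

∨-true⁻ : {a b : Bool} → a ∨ b ≡ true → a ≡ true ⊎ b ≡ true
∨-true⁻ {true}  _ = inj₁ refl
∨-true⁻ {false} t = inj₂ t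

∨-true⁺ˡ : {a b : Bool} → a ≡ true → a ∨ b ≡ true
∨-true⁺ˡ refl = refl

∨-true⁺ʳ : {a b : Bool} → b ≡ true → a ∨ b ≡ true
∨-true⁺ʳ {true}  _ = refl
∨-true⁺ʳ {false} t = t

not-true : {a : Bool} → not a ≡ true → a ≡ false
not-true {false} _ = refl

not-false : {a : Bool} → not a ≡ false → a ≡ true
not-false {true} _ = refl

true≢false : true ≢ false
true≢false ()

⌊≟⌋-refl : (x : Fin n) → ⌊ x ≟ x ⌋ ≡ true
⌊≟⌋-refl x with x ≟ x
... | yes _  = refl
... | no x≢x = ⊥-elim (x≢x refl)

⌊≟⌋-true : {x y : Fin n} → ⌊ x ≟ y ⌋ ≡ true → x ≡ y
⌊≟⌋-true {x = x} {y} t with x ≟ y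
... | yes x≡y = x≡y

⌊≟⌋-cong : ∀ {m} {x y : Fin n} {u v : Fin m} → (x ≡ y → u ≡ v) → (u ≡ v → x ≡ y) → ⌊ x ≟ y ⌋ ≡ ⌊ u ≟ v ⌋
⌊≟⌋-cong {x = x} {y} {u} {v} f g with x ≟ y | u ≟ v
... | yes _   | yes _   = refl
... | yes x≡y | no u≢v  = ⊥-elim (u≢v (f x≡y))
... | no x≢y  | yes u≡v = ⊥-elim (x≢y (g u≡v))
... | no _    | no _    = refl

cons-cong : {A : Set} {a b : A} {f g : Fin n → A} → a ≡ b → f ≗ g → cons a f ≗ cons b g
cons-cong a≡b f≗g zero    = a≡b
cons-cong a≡b f≗g (suc i) = f≗g i

cons-≗ : {A : Set} {a : A} {g : Fin n → A} {f : Fin (suc n) → A} → f zero ≡ a → g ≗ f ∘ suc → cons a g ≗ f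
cons-≗ f₀ g≗ zero    = sym f₀
cons-≗ f₀ g≗ (suc i) = g≗ i

anyFin-witness : (p : Fin n → Bool) → anyFin n p ≡ true → Σ (Fin n) λ i → p i ≡ true
anyFin-witness {suc n} p t with p zero in p₀
... | true  = zero , p₀
... | false = let i , pi = anyFin-witness (p ∘ suc) t in suc i , pi

anyFin-intro : (p : Fin n → Bool) (i : Fin n) → p i ≡ true → anyFin n p ≡ true
anyFin-intro p zero    pi = ∨-true⁺ˡ pi
anyFin-intro p (suc i) pi = ∨-true⁺ʳ {p zero} (anyFin-intro (p ∘ suc) i pi)

anyFin-none : (p : Fin n → Bool) → (∀ i → p i ≡ false) → anyFin n p ≡ false
anyFin-none {zero}  p allFalse = refl
anyFin-none {suc n} p allFalse rewrite allFalse zero = anyFin-none (p ∘ suc) (allFalse ∘ suc)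

anyFin-false : (p : Fin n → Bool) → anyFin n p ≡ false → ∀ i → p i ≡ false
anyFin-false p f i with p i in pi
... | false = refl
... | true  = ⊥-elim (true≢false (trans (sym (anyFin-intro p i pi)) f))

anyFin-cong : {p q : Fin n → Bool} → p ≗ q → anyFin n p ≡ anyFin n q
anyFin-cong {zero}  p≗q = refl
anyFin-cong {suc n} p≗q = cong₂ _∨_ (p≗q zero) (anyFin-cong (p≗q ∘ suc))

-- Subsets are functions, so a predicate on them must respect pointwise equality
-- before anySubset can be told about an arbitrary witness.
Extensional : {A : Set} → ((Fin n → Bool) → A) → Set
Extensional {n} p = ∀ {S S' : Fin n → Bool} → S ≗ S' → p S ≡ p S'

anySubset-witness : (p : (Fin n → Bool) → Bool) → anySubset n p ≡ true → Σ (Fin n → Bool) λ S → p S ≡ true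
anySubset-witness {zero}  p t = (λ ()) , t
anySubset-witness {suc n} p t with ∨-true⁻ t
... | inj₁ t₁ = let S , pS = anySubset-witness _ t₁ in cons true S , pS
... | inj₂ t₂ = let S , pS = anySubset-witness _ t₂ in cons false S , pS

anySubset-intro : (p : (Fin n → Bool) → Bool) → Extensional p → ∀ S → p S ≡ true → anySubset n p ≡ true
anySubset-intro {zero}  p ext S pS = trans (ext (λ ())) pS
anySubset-intro {suc n} p ext S pS with S zero in S₀
... | true  = ∨-true⁺ˡ (anySubset-intro (p ∘ cons true) (ext ∘ cons-cong refl) (S ∘ suc)
                          (trans (ext (cons-≗ S₀ (λ _ → refl))) pS))
... | false = ∨-true⁺ʳ (anySubset-intro (p ∘ cons false) (ext ∘ cons-cong refl) (S ∘ suc)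
                          (trans (ext (cons-≗ S₀ (λ _ → refl))) pS))

anySubset-none : (p : (Fin n → Bool) → Bool) → (∀ S → p S ≡ false) → anySubset n p ≡ false
anySubset-none {zero}  p allFalse = allFalse _
anySubset-none {suc n} p allFalse
  rewrite anySubset-none (p ∘ cons true) (allFalse ∘ cons true)
        | anySubset-none (p ∘ cons false) (allFalse ∘ cons false) = refl

anySubset-false : (p : (Fin n → Bool) → Bool) → Extensional p → anySubset n p ≡ false → ∀ S → p S ≡ false
anySubset-false p ext f S with p S in pS
... | false = refl
... | true  = ⊥-elim (true≢false (trans (sym (anySubset-intro p ext S pS)) f))

anySubset-cong : {p q : (Fin n → Bool) → Bool} → (∀ S → p S ≡ q S) → anySubset n p ≡ anySubset n q
anySubset-cong {zero}  p≗q = p≗q _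
anySubset-cong {suc n} p≗q = cong₂ _∨_ (anySubset-cong (p≗q ∘ cons true)) (anySubset-cong (p≗q ∘ cons false))

-- Semantics and Ehrenfeucht–Fraïssé games

_≋_ : (σ σ' : Fin ns → Fin n → Bool) → Set
σ ≋ σ' = ∀ X → σ X ≗ σ' X

cons-≋ : {S S' : Fin n → Bool} {σ σ' : Fin ns → Fin n → Bool} → S ≗ S' → σ ≋ σ' → cons S σ ≋ cons S' σ'
cons-≋ S≗S' σ≋σ' zero    = S≗S'
cons-≋ S≗S' σ≋σ' (suc X) = σ≋σ' X

≋-refl : {σ : Fin ns → Fin n → Bool} → σ ≋ σ
≋-refl X v = refl

sat-cong : (ψ : Formula nR c nf ns) (G : Graph nR) (P : Fin c → Fin (vert G) → Bool)
           {ρ ρ' : Fin nf → Fin (vert G)} {σ σ' : Fin ns → Fin (vert G) → Bool} →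
           ρ ≗ ρ' → σ ≋ σ' → sat ψ G P ρ σ ≡ sat ψ G P ρ' σ'
sat-cong (eq x y)    G P ρ≗ρ' σ≋σ' = cong₂ (λ u v → ⌊ u ≟ v ⌋) (ρ≗ρ' x) (ρ≗ρ' y)
sat-cong (rel R x y) G P ρ≗ρ' σ≋σ' = cong₂ (edge G R) (ρ≗ρ' x) (ρ≗ρ' y)
sat-cong (col a x)   G P ρ≗ρ' σ≋σ' = cong (P a) (ρ≗ρ' x)
sat-cong (mem x X)   G P {σ = σ} ρ≗ρ' σ≋σ' = trans (cong (σ X) (ρ≗ρ' x)) (σ≋σ' X _)
sat-cong (neg ψ)     G P ρ≗ρ' σ≋σ' = cong not (sat-cong ψ G P ρ≗ρ' σ≋σ')
sat-cong (and ψ χ)   G P ρ≗ρ' σ≋σ' = cong₂ _∧_ (sat-cong ψ G P ρ≗ρ' σ≋σ') (sat-cong χ G P ρ≗ρ' σ≋σ')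
sat-cong (ex1 ψ)     G P ρ≗ρ' σ≋σ' = anyFin-cong {vert G} (λ v → sat-cong ψ G P (cons-cong {a = v} refl ρ≗ρ') σ≋σ')
sat-cong (ex2 ψ)     G P ρ≗ρ' σ≋σ' = anySubset-cong {vert G} (λ S → sat-cong ψ G P ρ≗ρ' (cons-≋ {S = S} (λ _ → refl) σ≋σ'))

sat-extensional : (ψ : Formula nR c nf (suc ns)) (G : Graph nR) (P : Fin c → Fin (vert G) → Bool)
                  (ρ : Fin nf → Fin (vert G)) (σ : Fin ns → Fin (vert G) → Bool) →
                  Extensional (λ S → sat ψ G P ρ (cons S σ))
sat-extensional ψ G P ρ σ S≗S' = sat-cong ψ G P (λ _ → refl) (cons-≋ S≗S' ≋-refl)

Vertex : CGraph nR c → Set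
Vertex A = Fin (vert (graph A))

colourPred : (A : CGraph nR c) → Fin c → Vertex A → Bool
colourPred A a v = ⌊ colour A v ≟ a ⌋

⟦_⟧ : Formula nR c nf ns → (A : CGraph nR c) → (Fin nf → Vertex A) → (Fin ns → Vertex A → Bool) → Bool
⟦ ψ ⟧ A = sat ψ (graph A) (colourPred A)

-- A pebble that is `nothing` has not been placed in this structure; the join
-- construction needs this because a pebble of the joined graph lies in only one side.
Pebbles : ℕ → CGraph nR c → Set
Pebbles nf A = Fin nf → Maybe (Vertex A)

SetVars : ℕ → CGraph nR c → Set
SetVars ns A = Fin ns → Vertex A → Bool

Placed : {V : Set} → (Fin nf → Maybe V) → (Fin nf → V) → Set
Placed p ρ = ∀ i → p i ≡ just (ρ i)

Placed-cons : {V : Set} {p : Fin nf → Maybe V} {ρ : Fin nf → V} {v : V} →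
              Placed p ρ → Placed (cons (just v) p) (cons v ρ)
Placed-cons placed zero    = refl
Placed-cons placed (suc i) = placed i

module _ (A B : CGraph nR c) where

  Like₁ : SetVars ns A → SetVars ns B → Vertex A → Vertex B → Set
  Like₁ σA σB v w = colour A v ≡ colour B w × (∀ X → σA X v ≡ σB X w)

  Like₂ : Vertex A → Vertex A → Vertex B → Vertex B → Set
  Like₂ v v' w w' = ⌊ v ≟ v' ⌋ ≡ ⌊ w ≟ w' ⌋ × (∀ R → edge (graph A) R v v' ≡ edge (graph B) R w w')

  Agree₁ : SetVars ns A → SetVars ns B → Maybe (Vertex A) → Maybe (Vertex B) → Set
  Agree₁ σA σB nothing  nothing  = ⊤
  Agree₁ σA σB (just v) (just w) = Like₁ σA σB v w
  Agree₁ σA σB nothing  (just w) = ⊥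
  Agree₁ σA σB (just v) nothing  = ⊥

  Agree₂ : Maybe (Vertex A) → Maybe (Vertex A) → Maybe (Vertex B) → Maybe (Vertex B) → Set
  Agree₂ (just v) (just v') (just w) (just w') = Like₂ v v' w w'
  Agree₂ _        _         _        _         = ⊤

  AtomicAgree : Pebbles nf A → Pebbles nf B → SetVars ns A → SetVars ns B → Set
  AtomicAgree pA pB σA σB =
    (∀ i → Agree₁ σA σB (pA i) (pB i)) × (∀ i j → Agree₂ (pA i) (pA j) (pB i) (pB j))

  Position : Set₁
  Position = ∀ {nf ns} → Pebbles nf A → Pebbles nf B → SetVars ns A → SetVars ns B → Set

  record BackAndForth (Next : Position)
         (pA : Pebbles nf A) (pB : Pebbles nf B) (σA : SetVars ns A) (σB : SetVars ns B) : Set where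
    field
      atomic : AtomicAgree pA pB σA σB
      forth₁ : ∀ v → Σ (Vertex B) λ w → Next (cons (just v) pA) (cons (just w) pB) σA σB
      back₁  : ∀ w → Σ (Vertex A) λ v → Next (cons (just v) pA) (cons (just w) pB) σA σB
      forth₂ : ∀ S → Σ (Vertex B → Bool) λ S' → Next pA pB (cons S σA) (cons S' σB)
      back₂  : ∀ S' → Σ (Vertex A → Bool) λ S → Next pA pB (cons S σA) (cons S' σB)

  -- Duplicator wins the m-round Ehrenfeucht–Fraïssé game for MSO from this position.
  EF : ℕ → Position
  EF zero    = AtomicAgree
  EF (suc m) = BackAndForth (EF m)

open BackAndForth public

EF-atomic : ∀ {A B : CGraph nR c} m {pA : Pebbles nf A} {pB : Pebbles nf B} {σA : SetVars ns A} {σB} →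
            EF A B m pA pB σA σB → AtomicAgree A B pA pB σA σB
EF-atomic zero    g = g
EF-atomic (suc m) g = atomic g

module _ {A B : CGraph nR c} {ρA : Fin nf → Vertex A} {ρB : Fin nf → Vertex B}
         {pA : Pebbles nf A} {pB : Pebbles nf B} (hA : Placed pA ρA) (hB : Placed pB ρB) where

  Placed⇒Like₁ : {σA : SetVars ns A} {σB : SetVars ns B} →
                 AtomicAgree A B pA pB σA σB → ∀ i → Like₁ A B σA σB (ρA i) (ρB i)
  Placed⇒Like₁ {σA = σA} {σB} (agree₁ , _) i = subst₂ (Agree₁ A B σA σB) (hA i) (hB i) (agree₁ i)

  Placed⇒Like₂ : {σA : SetVars ns A} {σB : SetVars ns B} →
                 AtomicAgree A B pA pB σA σB → ∀ i j → Like₂ A B (ρA i) (ρA j) (ρB i) (ρB j)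
  Placed⇒Like₂ (_ , agree₂) i j =
    subst₂ (λ x y → Agree₂ A B x y (just (ρB i)) (just (ρB j))) (hA i) (hA j)
      (subst₂ (Agree₂ A B (pA i) (pA j)) (hB i) (hB j) (agree₂ i j))

  Like⇒AtomicAgree : {σA : SetVars ns A} {σB : SetVars ns B} →
                     (∀ i → Like₁ A B σA σB (ρA i) (ρB i)) → (∀ i j → Like₂ A B (ρA i) (ρA j) (ρB i) (ρB j)) →
                     AtomicAgree A B pA pB σA σB
  Like⇒AtomicAgree {σA = σA} {σB} like₁ like₂ =
    (λ i → subst₂ (Agree₁ A B σA σB) (sym (hA i)) (sym (hB i)) (like₁ i)) ,
    (λ i j → subst₂ (Agree₂ A B (pA i) (pA j)) (sym (hB i)) (sym (hB j))
               (subst₂ (λ x y → Agree₂ A B x y (just (ρB i)) (just (ρB j))) (sym (hA i)) (sym (hA j)) (like₂ i j)))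

EF-sound : ∀ m (ψ : Formula nR c nf ns) {A B : CGraph nR c} {ρA ρB} {pA : Pebbles nf A} {pB : Pebbles nf B}
           {σA : SetVars ns A} {σB : SetVars ns B} →
           Placed pA ρA → Placed pB ρB → EF A B m pA pB σA σB → qr ψ ≤ m → ⟦ ψ ⟧ A ρA σA ≡ ⟦ ψ ⟧ B ρB σB
EF-sound m (eq x y) hA hB g _ = proj₁ (Placed⇒Like₂ hA hB (EF-atomic m g) x y)
EF-sound m (rel R x y) hA hB g _ = proj₂ (Placed⇒Like₂ hA hB (EF-atomic m g) x y) R
EF-sound m (col a x) hA hB g _ = cong (λ b → ⌊ b ≟ a ⌋) (proj₁ (Placed⇒Like₁ hA hB (EF-atomic m g) x))
EF-sound m (mem x X) hA hB g _ = proj₂ (Placed⇒Like₁ hA hB (EF-atomic m g) x) X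
EF-sound m (neg ψ) hA hB g k = cong not (EF-sound m ψ hA hB g k)
EF-sound m (and ψ χ) hA hB g k =
  cong₂ _∧_ (EF-sound m ψ hA hB g (m⊔n≤o⇒m≤o (qr ψ) (qr χ) k)) (EF-sound m χ hA hB g (m⊔n≤o⇒n≤o (qr ψ) (qr χ) k))
EF-sound (suc m) (ex1 ψ) hA hB g (s≤s k) = true-iff⇒≡
  (λ t → let v , ψv = anyFin-witness _ t ; w , gvw = forth₁ g v in
         anyFin-intro _ w (trans (sym (EF-sound m ψ (Placed-cons hA) (Placed-cons hB) gvw k)) ψv))
  (λ t → let w , ψw = anyFin-witness _ t ; v , gvw = back₁ g w in
         anyFin-intro _ v (trans (EF-sound m ψ (Placed-cons hA) (Placed-cons hB) gvw k) ψw))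
EF-sound (suc m) (ex2 ψ) {A} {B} {ρA} {ρB} {σA = σA} {σB} hA hB g (s≤s k) = true-iff⇒≡
  (λ t → let S , ψS = anySubset-witness _ t ; S' , gSS' = forth₂ g S in
         anySubset-intro _ (sat-extensional ψ (graph B) (colourPred B) ρB σB) S'
           (trans (sym (EF-sound m ψ hA hB gSS' k)) ψS))
  (λ t → let S' , ψS' = anySubset-witness _ t ; S , gSS' = back₂ g S' in
         anySubset-intro _ (sat-extensional ψ (graph A) (colourPred A) ρA σA) S
           (trans (EF-sound m ψ hA hB gSS' k) ψS'))

Agree₂-unplacedʳ : (A B : CGraph nR c) (x : Maybe (Vertex A)) (y : Maybe (Vertex B)) → Agree₂ A B x nothing y nothing
Agree₂-unplacedʳ A B nothing  y = tt
Agree₂-unplacedʳ A B (just v) y = tt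

EF-weaken : ∀ m {A B : CGraph nR c} {pA : Pebbles nf A} {pB : Pebbles nf B} {σA : SetVars ns A} {σB} →
            EF A B (suc m) pA pB σA σB → EF A B m pA pB σA σB
EF-weaken zero    g = atomic g
EF-weaken (suc m) g .atomic    = atomic g
EF-weaken (suc m) g .forth₁ v  = let w , g' = forth₁ g v in w , EF-weaken m g'
EF-weaken (suc m) g .back₁  w  = let v , g' = back₁ g w in v , EF-weaken m g'
EF-weaken (suc m) g .forth₂ S  = let S' , g' = forth₂ g S in S' , EF-weaken m g'
EF-weaken (suc m) g .back₂  S' = let S , g' = back₂ g S' in S , EF-weaken m g'

Agree₁-≋ : {A B : CGraph nR c} {σA σA' : SetVars ns A} {σB : SetVars ns B} →
          σA ≋ σA' → ∀ x y → Agree₁ A B σA σB x y → Agree₁ A B σA' σB x y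
Agree₁-≋ σ≋ nothing  nothing  _             = tt
Agree₁-≋ σ≋ (just v) (just w) (same , sets) = same , λ X → trans (sym (σ≋ X v)) (sets X)

EF-≋ : ∀ m {A B : CGraph nR c} {pA : Pebbles nf A} {pB : Pebbles nf B} {σA σA' : SetVars ns A} {σB} →
       σA ≋ σA' → EF A B m pA pB σA σB → EF A B m pA pB σA' σB
EF-≋ zero    σ≋ (a₁ , a₂) = (λ i → Agree₁-≋ σ≋ _ _ (a₁ i)) , a₂
EF-≋ (suc m) σ≋ g .atomic    = let a₁ , a₂ = atomic g in (λ i → Agree₁-≋ σ≋ _ _ (a₁ i)) , a₂
EF-≋ (suc m) σ≋ g .forth₁ v  = let w , g' = forth₁ g v in w , EF-≋ m σ≋ g'
EF-≋ (suc m) σ≋ g .back₁  w  = let v , g' = back₁ g w in v , EF-≋ m σ≋ g'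
EF-≋ (suc m) σ≋ g .forth₂ S  = let S' , g' = forth₂ g S in S' , EF-≋ m (cons-≋ (λ _ → refl) σ≋) g'
EF-≋ (suc m) σ≋ g .back₂  S' = let S , g' = back₂ g S' in S , EF-≋ m (cons-≋ (λ _ → refl) σ≋) g'

Agree₂-subst : {A B : CGraph nR c} {x x' y y' : Maybe (Vertex A)} {u u' w w' : Maybe (Vertex B)} →
               x ≡ x' → y ≡ y' → u ≡ u' → w ≡ w' → Agree₂ A B x y u w → Agree₂ A B x' y' u' w'
Agree₂-subst refl refl refl refl agree = agree

Agree₁-just : ∀ {A B : CGraph nR c} {σA : SetVars ns A} {σB : SetVars ns B} {x y v w} →
              x ≡ just v → y ≡ just w → Agree₁ A B σA σB x y → Like₁ A B σA σB v w
Agree₁-just refl refl like = like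

Agree₂-just : ∀ {A B : CGraph nR c} {x x' y y' v v' w w'} →
              x ≡ just v → x' ≡ just v' → y ≡ just w → y' ≡ just w' → Agree₂ A B x x' y y' → Like₂ A B v v' w w'
Agree₂-just refl refl refl refl like = like

Agree₁-nothing-just : ∀ {A B : CGraph nR c} {σA : SetVars ns A} {σB : SetVars ns B} {x y w} →
                  x ≡ nothing → y ≡ just w → ¬ Agree₁ A B σA σB x y
Agree₁-nothing-just refl refl ()

Agree₁-just-nothing : ∀ {A B : CGraph nR c} {σA : SetVars ns A} {σB : SetVars ns B} {x y v} →
                   x ≡ just v → y ≡ nothing → ¬ Agree₁ A B σA σB x y
Agree₁-just-nothing refl refl ()

Reindexing : {VA VB : Set} → (Fin nf → Maybe VA) → (Fin nf → Maybe VB) →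
             (Fin nf' → Maybe VA) → (Fin nf' → Maybe VB) → Set
Reindexing {nf} pA pB qA qB =
  ∀ i → (qA i ≡ nothing × qB i ≡ nothing) ⊎ Σ (Fin nf) λ j → qA i ≡ pA j × qB i ≡ pB j

Reindexing-cons : {VA VB : Set} {pA : Fin nf → Maybe VA} {pB : Fin nf → Maybe VB}
                  {qA : Fin nf' → Maybe VA} {qB : Fin nf' → Maybe VB} {a : Maybe VA} {b : Maybe VB} →
                  Reindexing pA pB qA qB → Reindexing (cons a pA) (cons b pB) (cons a qA) (cons b qB)
Reindexing-cons re zero = inj₂ (zero , refl , refl)
Reindexing-cons re (suc i) with re i
... | inj₁ unplaced      = inj₁ unplaced
... | inj₂ (j , copies) = inj₂ (suc j , copies)

Reindexing-unplaced : {VA VB : Set} {pA : Fin nf → Maybe VA} {pB : Fin nf → Maybe VB} →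
                      Reindexing pA pB (cons nothing pA) (cons nothing pB)
Reindexing-unplaced zero    = inj₁ (refl , refl)
Reindexing-unplaced (suc i) = inj₂ (i , refl , refl)

AtomicAgree-reindex : {A B : CGraph nR c} {pA : Pebbles nf A} {pB : Pebbles nf B}
                      {qA : Pebbles nf' A} {qB : Pebbles nf' B} {σA : SetVars ns A} {σB : SetVars ns B} →
                      Reindexing pA pB qA qB → AtomicAgree A B pA pB σA σB → AtomicAgree A B qA qB σA σB
AtomicAgree-reindex {A = A} {B} {pA} {pB} {qA} {qB} {σA} {σB} re (a₁ , a₂) = agree₁ , agree₂
  where
  agree₁ : ∀ i → Agree₁ A B σA σB (qA i) (qB i)
  agree₁ i with re i
  ... | inj₁ (a , b)     = subst₂ (Agree₁ A B σA σB) (sym a) (sym b) tt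
  ... | inj₂ (j , a , b) = subst₂ (Agree₁ A B σA σB) (sym a) (sym b) (a₁ j)
  agree₂ : ∀ i j → Agree₂ A B (qA i) (qA j) (qB i) (qB j)
  agree₂ i j with re i | re j
  ... | inj₁ (a , b)      | _                   = Agree₂-subst (sym a) refl (sym b) refl tt
  ... | inj₂ (i' , a , b) | inj₁ (a' , b')      =
    Agree₂-subst (sym a) (sym a') (sym b) (sym b') (Agree₂-unplacedʳ A B (pA i') (pB i'))
  ... | inj₂ (i' , a , b) | inj₂ (j' , a' , b') = Agree₂-subst (sym a) (sym a') (sym b) (sym b') (a₂ i' j')

EF-reindex : ∀ m {A B : CGraph nR c} {pA : Pebbles nf A} {pB : Pebbles nf B}
             {qA : Pebbles nf' A} {qB : Pebbles nf' B} {σA : SetVars ns A} {σB : SetVars ns B} →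
             Reindexing pA pB qA qB → EF A B m pA pB σA σB → EF A B m qA qB σA σB
EF-reindex zero    re g = AtomicAgree-reindex re g
EF-reindex (suc m) re g .atomic    = AtomicAgree-reindex re (atomic g)
EF-reindex (suc m) re g .forth₁ v  = let w , g' = forth₁ g v in w , EF-reindex m (Reindexing-cons re) g'
EF-reindex (suc m) re g .back₁  w  = let v , g' = back₁ g w in v , EF-reindex m (Reindexing-cons re) g'
EF-reindex (suc m) re g .forth₂ S  = let S' , g' = forth₂ g S in S' , EF-reindex m re g'
EF-reindex (suc m) re g .back₂  S' = let S , g' = back₂ g S' in S , EF-reindex m re g'

recoloured : (A : CGraph nR c) → (Vertex A → Fin c') → CGraph nR c'
recoloured A f = record { graph = graph A ; colour = f }

module _ {A B : CGraph nR c} (fA : Vertex A → Fin c') (fB : Vertex B → Fin c')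
         (respects : ∀ v w → colour A v ≡ colour B w → fA v ≡ fB w) where

  Agree₁-recolour : {σA : SetVars ns A} {σB : SetVars ns B} → ∀ x y →
                    Agree₁ A B σA σB x y → Agree₁ (recoloured A fA) (recoloured B fB) σA σB x y
  Agree₁-recolour nothing  nothing  _             = tt
  Agree₁-recolour (just v) (just w) (same , sets) = respects v w same , sets

  Agree₂-recolour : ∀ x x' y y' → Agree₂ A B x x' y y' → Agree₂ (recoloured A fA) (recoloured B fB) x x' y y'
  Agree₂-recolour (just v) (just v') (just w) (just w') like = like
  Agree₂-recolour nothing  _         _        _         _    = tt
  Agree₂-recolour (just v) nothing   _        _         _    = tt
  Agree₂-recolour (just v) (just v') nothing  _         _    = tt
  Agree₂-recolour (just v) (just v') (just w) nothing   _    = tt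

  AtomicAgree-recolour : {pA : Pebbles nf A} {pB : Pebbles nf B} {σA : SetVars ns A} {σB : SetVars ns B} →
                         AtomicAgree A B pA pB σA σB → AtomicAgree (recoloured A fA) (recoloured B fB) pA pB σA σB
  AtomicAgree-recolour (a₁ , a₂) = (λ i → Agree₁-recolour _ _ (a₁ i)) , (λ i j → Agree₂-recolour _ _ _ _ (a₂ i j))

  EF-recolour : ∀ m {pA : Pebbles nf A} {pB : Pebbles nf B} {σA : SetVars ns A} {σB : SetVars ns B} →
                EF A B m pA pB σA σB → EF (recoloured A fA) (recoloured B fB) m pA pB σA σB
  EF-recolour zero    g = AtomicAgree-recolour g
  EF-recolour (suc m) g .atomic    = AtomicAgree-recolour (atomic g)
  EF-recolour (suc m) g .forth₁ v  = let w , g' = forth₁ g v in w , EF-recolour m g'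
  EF-recolour (suc m) g .back₁  w  = let v , g' = back₁ g w in v , EF-recolour m g'
  EF-recolour (suc m) g .forth₂ S  = let S' , g' = forth₂ g S in S' , EF-recolour m g'
  EF-recolour (suc m) g .back₂  S' = let S , g' = back₂ g S' in S , EF-recolour m g'

module _ {A B : CGraph nR c} (f : Vertex A ↔ Vertex B)
         (edges : ∀ R u v → edge (graph B) R (Inverse.to f u) (Inverse.to f v) ≡ edge (graph A) R u v)
         (colours : ∀ v → colour B (Inverse.to f v) ≡ colour A v) where
  open Inverse f using (to; from) renaming (strictlyInverseˡ to to∘from; strictlyInverseʳ to from∘to)

  cons-pebbles : {pA : Pebbles nf A} {pB : Pebbles nf B} {v : Vertex A} {w : Vertex B} →
                 w ≡ to v → (∀ i → pB i ≡ Maybe.map to (pA i)) → ∀ i → cons (just w) pB i ≡ Maybe.map to (cons (just v) pA i)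
  cons-pebbles w≡ pebbles zero    = cong just w≡
  cons-pebbles w≡ pebbles (suc i) = pebbles i

  cons-sets : {σA : SetVars ns A} {σB : SetVars ns B} {S : Vertex A → Bool} {S' : Vertex B → Bool} →
              (∀ v → S' (to v) ≡ S v) → (∀ X v → σB X (to v) ≡ σA X v) → ∀ X v → cons S' σB X (to v) ≡ cons S σA X v
  cons-sets S' S zero    v = S' v
  cons-sets S' S (suc X) v = S X v

  AtomicAgree-iso : {pA : Pebbles nf A} {pB : Pebbles nf B} {σA : SetVars ns A} {σB : SetVars ns B} →
                    (∀ i → pB i ≡ Maybe.map to (pA i)) → (∀ X v → σB X (to v) ≡ σA X v) → AtomicAgree A B pA pB σA σB
  AtomicAgree-iso {pA = pA} {pB} {σA} {σB} pebbles sets =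
    (λ i → agree₁ (pA i) (pB i) (pebbles i)) , (λ i j → agree₂ _ _ _ _ (pebbles i) (pebbles j))
    where
    agree₁ : ∀ x y → y ≡ Maybe.map to x → Agree₁ A B σA σB x y
    agree₁ nothing  .nothing        refl = tt
    agree₁ (just v) .(just (to v)) refl = sym (colours v) , λ X → sym (sets X v)
    agree₂ : ∀ x x' y y' → y ≡ Maybe.map to x → y' ≡ Maybe.map to x' → Agree₂ A B x x' y y'
    agree₂ (just v) (just v') .(just (to v)) .(just (to v')) refl refl =
      ⌊≟⌋-cong (cong to) (λ eq → trans (sym (from∘to v)) (trans (cong from eq) (from∘to v'))) ,
      λ R → sym (edges R v v')
    agree₂ nothing  _        _ _ _ _ = tt
    agree₂ (just v) nothing  _ _ _ _ = tt

  EF-iso : ∀ m {pA : Pebbles nf A} {pB : Pebbles nf B} {σA : SetVars ns A} {σB : SetVars ns B} →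
           (∀ i → pB i ≡ Maybe.map to (pA i)) → (∀ X v → σB X (to v) ≡ σA X v) → EF A B m pA pB σA σB
  EF-iso zero    pebbles sets = AtomicAgree-iso pebbles sets
  EF-iso (suc m) pebbles sets .atomic    = AtomicAgree-iso pebbles sets
  EF-iso (suc m) pebbles sets .forth₁ v  = to v , EF-iso m (cons-pebbles refl pebbles) sets
  EF-iso (suc m) pebbles sets .back₁  w  = from w , EF-iso m (cons-pebbles (sym (to∘from w)) pebbles) sets
  EF-iso (suc m) pebbles sets .forth₂ S  = S ∘ from , EF-iso m pebbles (cons-sets (λ v → cong S (from∘to v)) sets)
  EF-iso (suc m) pebbles sets .back₂  S' = S' ∘ to , EF-iso m pebbles (cons-sets (λ v → refl) sets)

-- Hintikka formulas

-- `nothing` stands for the true formula, which the syntax lacks: without free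
-- first-order variables there is no atomic formula, hence no sentence of rank 0.
Formula⊤ : ℕ → ℕ → ℕ → ℕ → Set
Formula⊤ nR c nf ns = Maybe (Formula nR c nf ns)

⟦_⟧⊤ : Formula⊤ nR c nf ns → (B : CGraph nR c) → (Fin nf → Vertex B) → SetVars ns B → Bool
⟦ nothing ⟧⊤ B ρ σ = true
⟦ just ψ  ⟧⊤ B ρ σ = ⟦ ψ ⟧ B ρ σ

qr⊤ : Formula⊤ nR c nf ns → ℕ
qr⊤ nothing  = 0
qr⊤ (just ψ) = qr ψ

⟦⟧⊤-cong : (φ : Formula⊤ nR c nf ns) {B : CGraph nR c} {ρ : Fin nf → Vertex B} {σ σ' : SetVars ns B} →
           σ ≋ σ' → ⟦ φ ⟧⊤ B ρ σ ≡ ⟦ φ ⟧⊤ B ρ σ'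
⟦⟧⊤-cong nothing  σ≋σ' = refl
⟦⟧⊤-cong (just ψ) {B} σ≋σ' = sat-cong ψ (graph B) (colourPred B) (λ _ → refl) σ≋σ'

_∧⊤_ : Formula⊤ nR c nf ns → Formula⊤ nR c nf ns → Formula⊤ nR c nf ns
nothing ∧⊤ φ       = φ
just ψ  ∧⊤ nothing = just ψ
just ψ  ∧⊤ just χ  = just (and ψ χ)

_∨⊤_ : Formula⊤ nR c nf ns → Formula⊤ nR c nf ns → Formula⊤ nR c nf ns
nothing ∨⊤ φ       = nothing
just ψ  ∨⊤ nothing = nothing
just ψ  ∨⊤ just χ  = just (neg (and (neg ψ) (neg χ)))

∃¹⊤ : Formula⊤ nR c (suc nf) ns → Formula⊤ nR c nf ns
∃¹⊤ nothing  = just (ex1 (eq zero zero))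
∃¹⊤ (just ψ) = just (ex1 ψ)

∀¹⊤ : Formula⊤ nR c (suc nf) ns → Formula⊤ nR c nf ns
∀¹⊤ nothing  = nothing
∀¹⊤ (just ψ) = just (neg (ex1 (neg ψ)))

∃²⊤ : Formula⊤ nR c nf (suc ns) → Formula⊤ nR c nf ns
∃²⊤ nothing  = nothing
∃²⊤ (just ψ) = just (ex2 ψ)

∀²⊤ : Formula⊤ nR c nf (suc ns) → Formula⊤ nR c nf ns
∀²⊤ nothing  = nothing
∀²⊤ (just ψ) = just (neg (ex2 (neg ψ)))

⋀ : ∀ k → (Fin k → Formula⊤ nR c nf ns) → Formula⊤ nR c nf ns
⋀ zero    F = nothing
⋀ (suc k) F = F zero ∧⊤ ⋀ k (F ∘ suc)

⋁ : ∀ k → (Fin k → Formula⊤ nR c (suc nf) ns) → Formula⊤ nR c (suc nf) ns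
⋁ zero    F = just (neg (eq zero zero))
⋁ (suc k) F = F zero ∨⊤ ⋁ k (F ∘ suc)

⋀ˢ : ∀ k → ((Fin k → Bool) → Formula⊤ nR c nf ns) → Formula⊤ nR c nf ns
⋀ˢ zero    F = F (λ ())
⋀ˢ (suc k) F = ⋀ˢ k (F ∘ cons true) ∧⊤ ⋀ˢ k (F ∘ cons false)

⋁ˢ : ∀ k → ((Fin k → Bool) → Formula⊤ nR c nf ns) → Formula⊤ nR c nf ns
⋁ˢ zero    F = F (λ ())
⋁ˢ (suc k) F = ⋁ˢ k (F ∘ cons true) ∨⊤ ⋁ˢ k (F ∘ cons false)

literal : Bool → Formula nR c nf ns → Formula⊤ nR c nf ns
literal true  ψ = just ψ
literal false ψ = just (neg ψ)

∧⊤-qr : (φ χ : Formula⊤ nR c nf ns) → qr⊤ φ ≤ m → qr⊤ χ ≤ m → qr⊤ (φ ∧⊤ χ) ≤ m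
∧⊤-qr nothing  χ        _ k = k
∧⊤-qr (just ψ) nothing  k _ = k
∧⊤-qr (just ψ) (just χ) k l = ⊔-lub k l

∨⊤-qr : (φ χ : Formula⊤ nR c nf ns) → qr⊤ φ ≤ m → qr⊤ χ ≤ m → qr⊤ (φ ∨⊤ χ) ≤ m
∨⊤-qr nothing  χ        _ _ = z≤n
∨⊤-qr (just ψ) nothing  _ _ = z≤n
∨⊤-qr (just ψ) (just χ) k l = ⊔-lub k l

∃¹⊤-qr : (φ : Formula⊤ nR c (suc nf) ns) → qr⊤ φ ≤ m → qr⊤ (∃¹⊤ φ) ≤ suc m
∃¹⊤-qr nothing  _ = s≤s z≤n
∃¹⊤-qr (just ψ) k = s≤s k

∀¹⊤-qr : (φ : Formula⊤ nR c (suc nf) ns) → qr⊤ φ ≤ m → qr⊤ (∀¹⊤ φ) ≤ suc m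
∀¹⊤-qr nothing  _ = z≤n
∀¹⊤-qr (just ψ) k = s≤s k

∃²⊤-qr : (φ : Formula⊤ nR c nf (suc ns)) → qr⊤ φ ≤ m → qr⊤ (∃²⊤ φ) ≤ suc m
∃²⊤-qr nothing  _ = z≤n
∃²⊤-qr (just ψ) k = s≤s k

∀²⊤-qr : (φ : Formula⊤ nR c nf (suc ns)) → qr⊤ φ ≤ m → qr⊤ (∀²⊤ φ) ≤ suc m
∀²⊤-qr nothing  _ = z≤n
∀²⊤-qr (just ψ) k = s≤s k

⋀-qr : ∀ k (F : Fin k → Formula⊤ nR c nf ns) → (∀ i → qr⊤ (F i) ≤ m) → qr⊤ (⋀ k F) ≤ m
⋀-qr zero    F k = z≤n
⋀-qr (suc k) F l = ∧⊤-qr (F zero) _ (l zero) (⋀-qr k (F ∘ suc) (l ∘ suc))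

⋁-qr : ∀ k (F : Fin k → Formula⊤ nR c (suc nf) ns) → (∀ i → qr⊤ (F i) ≤ m) → qr⊤ (⋁ k F) ≤ m
⋁-qr zero    F k = z≤n
⋁-qr (suc k) F l = ∨⊤-qr (F zero) _ (l zero) (⋁-qr k (F ∘ suc) (l ∘ suc))

⋀ˢ-qr : ∀ k (F : (Fin k → Bool) → Formula⊤ nR c nf ns) → (∀ S → qr⊤ (F S) ≤ m) → qr⊤ (⋀ˢ k F) ≤ m
⋀ˢ-qr zero    F l = l _
⋀ˢ-qr (suc k) F l = ∧⊤-qr (⋀ˢ k _) _ (⋀ˢ-qr k _ (l ∘ cons true)) (⋀ˢ-qr k _ (l ∘ cons false))

⋁ˢ-qr : ∀ k (F : (Fin k → Bool) → Formula⊤ nR c nf ns) → (∀ S → qr⊤ (F S) ≤ m) → qr⊤ (⋁ˢ k F) ≤ m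
⋁ˢ-qr zero    F l = l _
⋁ˢ-qr (suc k) F l = ∨⊤-qr (⋁ˢ k _) _ (⋁ˢ-qr k _ (l ∘ cons true)) (⋁ˢ-qr k _ (l ∘ cons false))

literal-qr : ∀ b (ψ : Formula nR c nf ns) → qr ψ ≤ m → qr⊤ (literal b ψ) ≤ m
literal-qr true  ψ k = k
literal-qr false ψ k = k

module _ {B : CGraph nR c} where

  ∧⊤-intro : (φ χ : Formula⊤ nR c nf ns) {ρ : Fin nf → Vertex B} {σ : SetVars ns B} →
             ⟦ φ ⟧⊤ B ρ σ ≡ true → ⟦ χ ⟧⊤ B ρ σ ≡ true → ⟦ φ ∧⊤ χ ⟧⊤ B ρ σ ≡ true
  ∧⊤-intro nothing  χ        t u = u
  ∧⊤-intro (just ψ) nothing  t u = t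
  ∧⊤-intro (just ψ) (just χ) t u = ∧-true⁺ t u

  ∧⊤-elim : (φ χ : Formula⊤ nR c nf ns) {ρ : Fin nf → Vertex B} {σ : SetVars ns B} →
            ⟦ φ ∧⊤ χ ⟧⊤ B ρ σ ≡ true → ⟦ φ ⟧⊤ B ρ σ ≡ true × ⟦ χ ⟧⊤ B ρ σ ≡ true
  ∧⊤-elim nothing  χ        t = refl , t
  ∧⊤-elim (just ψ) nothing  t = t , refl
  ∧⊤-elim (just ψ) (just χ) t = ∧-true⁻ t

  ∨⊤-introˡ : (φ χ : Formula⊤ nR c nf ns) {ρ : Fin nf → Vertex B} {σ : SetVars ns B} →
              ⟦ φ ⟧⊤ B ρ σ ≡ true → ⟦ φ ∨⊤ χ ⟧⊤ B ρ σ ≡ true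
  ∨⊤-introˡ nothing  χ        t = refl
  ∨⊤-introˡ (just ψ) nothing  t = refl
  ∨⊤-introˡ (just ψ) (just χ) t rewrite t = refl

  ∨⊤-introʳ : (φ χ : Formula⊤ nR c nf ns) {ρ : Fin nf → Vertex B} {σ : SetVars ns B} →
              ⟦ χ ⟧⊤ B ρ σ ≡ true → ⟦ φ ∨⊤ χ ⟧⊤ B ρ σ ≡ true
  ∨⊤-introʳ nothing  χ        t = refl
  ∨⊤-introʳ (just ψ) nothing  t = refl
  ∨⊤-introʳ (just ψ) (just χ) {ρ} {σ} t rewrite t with ⟦ ψ ⟧ B ρ σ
  ... | true  = refl
  ... | false = refl

  ∨⊤-elim : (φ χ : Formula⊤ nR c nf ns) {ρ : Fin nf → Vertex B} {σ : SetVars ns B} →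
            ⟦ φ ∨⊤ χ ⟧⊤ B ρ σ ≡ true → ⟦ φ ⟧⊤ B ρ σ ≡ true ⊎ ⟦ χ ⟧⊤ B ρ σ ≡ true
  ∨⊤-elim nothing  χ        t = inj₁ refl
  ∨⊤-elim (just ψ) nothing  t = inj₂ refl
  ∨⊤-elim (just ψ) (just χ) {ρ} {σ} t with ⟦ ψ ⟧ B ρ σ | ⟦ χ ⟧ B ρ σ
  ... | true  | _    = inj₁ refl
  ... | false | true = inj₂ refl

  ∃¹⊤-intro : (φ : Formula⊤ nR c (suc nf) ns) {ρ : Fin nf → Vertex B} {σ : SetVars ns B} →
              ∀ v → ⟦ φ ⟧⊤ B (cons v ρ) σ ≡ true → ⟦ ∃¹⊤ φ ⟧⊤ B ρ σ ≡ true
  ∃¹⊤-intro nothing  v t = anyFin-intro _ v (⌊≟⌋-refl v)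
  ∃¹⊤-intro (just ψ) v t = anyFin-intro _ v t

  ∃¹⊤-elim : (φ : Formula⊤ nR c (suc nf) ns) {ρ : Fin nf → Vertex B} {σ : SetVars ns B} →
             ⟦ ∃¹⊤ φ ⟧⊤ B ρ σ ≡ true → Σ (Vertex B) λ v → ⟦ φ ⟧⊤ B (cons v ρ) σ ≡ true
  ∃¹⊤-elim nothing  t = proj₁ (anyFin-witness _ t) , refl
  ∃¹⊤-elim (just ψ) t = anyFin-witness _ t

  ∀¹⊤-intro : (φ : Formula⊤ nR c (suc nf) ns) {ρ : Fin nf → Vertex B} {σ : SetVars ns B} →
              (∀ v → ⟦ φ ⟧⊤ B (cons v ρ) σ ≡ true) → ⟦ ∀¹⊤ φ ⟧⊤ B ρ σ ≡ true
  ∀¹⊤-intro nothing  all = refl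
  ∀¹⊤-intro (just ψ) all = cong not (anyFin-none _ (λ v → cong not (all v)))

  ∀¹⊤-elim : (φ : Formula⊤ nR c (suc nf) ns) {ρ : Fin nf → Vertex B} {σ : SetVars ns B} →
             ⟦ ∀¹⊤ φ ⟧⊤ B ρ σ ≡ true → ∀ v → ⟦ φ ⟧⊤ B (cons v ρ) σ ≡ true
  ∀¹⊤-elim nothing  t v = refl
  ∀¹⊤-elim (just ψ) t v = not-false (anyFin-false _ (not-true t) v)

  ∃²⊤-intro : (φ : Formula⊤ nR c nf (suc ns)) {ρ : Fin nf → Vertex B} {σ : SetVars ns B} →
              ∀ S → ⟦ φ ⟧⊤ B ρ (cons S σ) ≡ true → ⟦ ∃²⊤ φ ⟧⊤ B ρ σ ≡ true
  ∃²⊤-intro nothing  S t = refl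
  ∃²⊤-intro (just ψ) {ρ} {σ} S t = anySubset-intro _ (sat-extensional ψ (graph B) (colourPred B) ρ σ) S t

  ∃²⊤-elim : (φ : Formula⊤ nR c nf (suc ns)) {ρ : Fin nf → Vertex B} {σ : SetVars ns B} →
             ⟦ ∃²⊤ φ ⟧⊤ B ρ σ ≡ true → Σ (Vertex B → Bool) λ S → ⟦ φ ⟧⊤ B ρ (cons S σ) ≡ true
  ∃²⊤-elim nothing  t = (λ _ → false) , refl
  ∃²⊤-elim (just ψ) t = anySubset-witness _ t

  ∀²⊤-intro : (φ : Formula⊤ nR c nf (suc ns)) {ρ : Fin nf → Vertex B} {σ : SetVars ns B} →
              (∀ S → ⟦ φ ⟧⊤ B ρ (cons S σ) ≡ true) → ⟦ ∀²⊤ φ ⟧⊤ B ρ σ ≡ true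
  ∀²⊤-intro nothing  all = refl
  ∀²⊤-intro (just ψ) all = cong not (anySubset-none _ (λ S → cong not (all S)))

  ∀²⊤-elim : (φ : Formula⊤ nR c nf (suc ns)) {ρ : Fin nf → Vertex B} {σ : SetVars ns B} →
             ⟦ ∀²⊤ φ ⟧⊤ B ρ σ ≡ true → ∀ S → ⟦ φ ⟧⊤ B ρ (cons S σ) ≡ true
  ∀²⊤-elim nothing  t S = refl
  ∀²⊤-elim (just ψ) {ρ} {σ} t S =
    not-false (anySubset-false _ (cong not ∘ sat-extensional ψ (graph B) (colourPred B) ρ σ) (not-true t) S)

  ⋀-intro : ∀ k (F : Fin k → Formula⊤ nR c nf ns) {ρ : Fin nf → Vertex B} {σ : SetVars ns B} →
            (∀ i → ⟦ F i ⟧⊤ B ρ σ ≡ true) → ⟦ ⋀ k F ⟧⊤ B ρ σ ≡ true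
  ⋀-intro zero    F all = refl
  ⋀-intro (suc k) F all = ∧⊤-intro (F zero) _ (all zero) (⋀-intro k (F ∘ suc) (all ∘ suc))

  ⋀-elim : ∀ k (F : Fin k → Formula⊤ nR c nf ns) {ρ : Fin nf → Vertex B} {σ : SetVars ns B} →
           ⟦ ⋀ k F ⟧⊤ B ρ σ ≡ true → ∀ i → ⟦ F i ⟧⊤ B ρ σ ≡ true
  ⋀-elim (suc k) F t zero    = proj₁ (∧⊤-elim (F zero) _ t)
  ⋀-elim (suc k) F t (suc i) = ⋀-elim k (F ∘ suc) (proj₂ (∧⊤-elim (F zero) _ t)) i

  ⋁-intro : ∀ k (F : Fin k → Formula⊤ nR c (suc nf) ns) {ρ : Fin (suc nf) → Vertex B} {σ : SetVars ns B} →
            ∀ i → ⟦ F i ⟧⊤ B ρ σ ≡ true → ⟦ ⋁ k F ⟧⊤ B ρ σ ≡ true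
  ⋁-intro (suc k) F zero    t = ∨⊤-introˡ (F zero) _ t
  ⋁-intro (suc k) F (suc i) t = ∨⊤-introʳ (F zero) _ (⋁-intro k (F ∘ suc) i t)

  ⋁-elim : ∀ k (F : Fin k → Formula⊤ nR c (suc nf) ns) {ρ : Fin (suc nf) → Vertex B} {σ : SetVars ns B} →
           ⟦ ⋁ k F ⟧⊤ B ρ σ ≡ true → Σ (Fin k) λ i → ⟦ F i ⟧⊤ B ρ σ ≡ true
  ⋁-elim zero    F {ρ} t = ⊥-elim (true≢false (trans (sym (⌊≟⌋-refl (ρ zero))) (not-true t)))
  ⋁-elim (suc k) F t with ∨⊤-elim (F zero) _ t
  ... | inj₁ t₀ = zero , t₀
  ... | inj₂ t₁ = let i , tᵢ = ⋁-elim k (F ∘ suc) t₁ in suc i , tᵢ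

  ⋀ˢ-intro : ∀ k (F : (Fin k → Bool) → Formula⊤ nR c nf ns) {ρ : Fin nf → Vertex B} {σ : SetVars ns B} →
             (∀ S → ⟦ F S ⟧⊤ B ρ σ ≡ true) → ⟦ ⋀ˢ k F ⟧⊤ B ρ σ ≡ true
  ⋀ˢ-intro zero    F all = all _
  ⋀ˢ-intro (suc k) F all = ∧⊤-intro (⋀ˢ k _) _ (⋀ˢ-intro k _ (all ∘ cons true)) (⋀ˢ-intro k _ (all ∘ cons false))

  -- Only a pointwise copy of S is among the enumerated conjuncts.
  ⋀ˢ-elim : ∀ k (F : (Fin k → Bool) → Formula⊤ nR c nf ns) {ρ : Fin nf → Vertex B} {σ : SetVars ns B} →
            ⟦ ⋀ˢ k F ⟧⊤ B ρ σ ≡ true → ∀ S → Σ (Fin k → Bool) λ S' → S' ≗ S × ⟦ F S' ⟧⊤ B ρ σ ≡ true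
  ⋀ˢ-elim zero    F t S = _ , (λ ()) , t
  ⋀ˢ-elim (suc k) F t S with S zero in S₀ | ∧⊤-elim (⋀ˢ k (F ∘ cons true)) _ t
  ... | true  | t₁ , _ = let S' , S'≗ , tS' = ⋀ˢ-elim k _ t₁ (S ∘ suc) in cons true S' , cons-≗ S₀ S'≗ , tS'
  ... | false | _ , t₂ = let S' , S'≗ , tS' = ⋀ˢ-elim k _ t₂ (S ∘ suc) in cons false S' , cons-≗ S₀ S'≗ , tS'

  ⋁ˢ-intro : ∀ k (F : (Fin k → Bool) → Formula⊤ nR c nf ns) {ρ : Fin nf → Vertex B} {σ : SetVars ns B} →
             ∀ S → (∀ S' → S' ≗ S → ⟦ F S' ⟧⊤ B ρ σ ≡ true) → ⟦ ⋁ˢ k F ⟧⊤ B ρ σ ≡ true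
  ⋁ˢ-intro zero    F S t = t _ (λ ())
  ⋁ˢ-intro (suc k) F S t with S zero in S₀
  ... | true  = ∨⊤-introˡ (⋁ˢ k _) _ (⋁ˢ-intro k _ (S ∘ suc) (λ S' S'≗ → t _ (cons-≗ S₀ S'≗)))
  ... | false = ∨⊤-introʳ (⋁ˢ k _) _ (⋁ˢ-intro k _ (S ∘ suc) (λ S' S'≗ → t _ (cons-≗ S₀ S'≗)))

  ⋁ˢ-elim : ∀ k (F : (Fin k → Bool) → Formula⊤ nR c nf ns) {ρ : Fin nf → Vertex B} {σ : SetVars ns B} →
            ⟦ ⋁ˢ k F ⟧⊤ B ρ σ ≡ true → Σ (Fin k → Bool) λ S → ⟦ F S ⟧⊤ B ρ σ ≡ true
  ⋁ˢ-elim zero    F t = _ , t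
  ⋁ˢ-elim (suc k) F t with ∨⊤-elim (⋁ˢ k (F ∘ cons true)) _ t
  ... | inj₁ t₁ = let S , tS = ⋁ˢ-elim k _ t₁ in cons true S , tS
  ... | inj₂ t₂ = let S , tS = ⋁ˢ-elim k _ t₂ in cons false S , tS

  literal-intro : ∀ b (ψ : Formula nR c nf ns) {ρ : Fin nf → Vertex B} {σ : SetVars ns B} →
                  ⟦ ψ ⟧ B ρ σ ≡ b → ⟦ literal b ψ ⟧⊤ B ρ σ ≡ true
  literal-intro true  ψ t = t
  literal-intro false ψ t = cong not t

  literal-elim : ∀ b (ψ : Formula nR c nf ns) {ρ : Fin nf → Vertex B} {σ : SetVars ns B} →
                 ⟦ literal b ψ ⟧⊤ B ρ σ ≡ true → ⟦ ψ ⟧ B ρ σ ≡ b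
  literal-elim true  ψ t = t
  literal-elim false ψ t = not-true t

module _ (A : CGraph nR c) (ρ : Fin nf → Vertex A) where

  colourAtom : Fin nf → Formula⊤ nR c nf ns
  colourAtom i = just (col (colour A (ρ i)) i)

  memberships : SetVars ns A → Fin nf → Formula⊤ nR c nf ns
  memberships {ns} σ i = ⋀ ns (λ X → literal (σ X (ρ i)) (mem i X))

  equality : Fin nf → Fin nf → Formula⊤ nR c nf ns
  equality i j = literal ⌊ ρ i ≟ ρ j ⌋ (eq i j)

  relations : Fin nf → Fin nf → Formula⊤ nR c nf ns
  relations i j = ⋀ nR (λ R → literal (edge (graph A) R (ρ i) (ρ j)) (rel R i j))

  vertexDiagram : SetVars ns A → Fin nf → Formula⊤ nR c nf ns
  vertexDiagram σ i = colourAtom i ∧⊤ memberships σ i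

  pairDiagram : Fin nf → Fin nf → Formula⊤ nR c nf ns
  pairDiagram i j = equality i j ∧⊤ relations i j

  diagram : SetVars ns A → Formula⊤ nR c nf ns
  diagram σ = ⋀ nf (vertexDiagram σ) ∧⊤ ⋀ nf (λ i → ⋀ nf (pairDiagram i))

  diagram-qr : (σ : SetVars ns A) → qr⊤ (diagram σ) ≤ m
  diagram-qr {ns} σ =
    ∧⊤-qr (⋀ nf (vertexDiagram σ)) _
      (⋀-qr nf (vertexDiagram σ) λ i → ∧⊤-qr (colourAtom i) (memberships σ i) z≤n
        (⋀-qr ns (λ X → literal (σ X (ρ i)) (mem i X)) λ X → literal-qr (σ X (ρ i)) (mem i X) z≤n))
      (⋀-qr nf (λ i → ⋀ nf (pairDiagram i)) λ i → ⋀-qr nf (pairDiagram i) λ j →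
        ∧⊤-qr (equality i j) (relations i j) (literal-qr ⌊ ρ i ≟ ρ j ⌋ (eq i j) z≤n)
          (⋀-qr nR (λ R → literal (edge (graph A) R (ρ i) (ρ j)) (rel R i j)) λ R →
            literal-qr (edge (graph A) R (ρ i) (ρ j)) (rel R i j) z≤n))

  diagram-self : (σ : SetVars ns A) → ⟦ diagram σ ⟧⊤ A ρ σ ≡ true
  diagram-self {ns} σ =
    ∧⊤-intro (⋀ nf (vertexDiagram σ)) _
      (⋀-intro nf (vertexDiagram σ) λ i → ∧⊤-intro (colourAtom i) (memberships σ i) (⌊≟⌋-refl (colour A (ρ i)))
        (⋀-intro ns (λ X → literal (σ X (ρ i)) (mem i X)) λ X → literal-intro (σ X (ρ i)) (mem i X) refl))
      (⋀-intro nf (λ i → ⋀ nf (pairDiagram i)) λ i → ⋀-intro nf (pairDiagram i) λ j →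
        ∧⊤-intro (equality i j) (relations i j) (literal-intro ⌊ ρ i ≟ ρ j ⌋ (eq i j) refl)
          (⋀-intro nR (λ R → literal (edge (graph A) R (ρ i) (ρ j)) (rel R i j)) λ R →
            literal-intro (edge (graph A) R (ρ i) (ρ j)) (rel R i j) refl))

diagram-complete : {A B : CGraph nR c} {ρA : Fin nf → Vertex A} {ρB : Fin nf → Vertex B}
                   {pA : Pebbles nf A} {pB : Pebbles nf B} {σA : SetVars ns A} {σB : SetVars ns B} →
                   ⟦ diagram A ρA σA ⟧⊤ B ρB σB ≡ true → Placed pA ρA → Placed pB ρB → AtomicAgree A B pA pB σA σB
diagram-complete {nR} {nf = nf} {ns} {A} {B} {ρA} {ρB} {σA = σA} {σB} t hA hB =
  Like⇒AtomicAgree hA hB like₁ like₂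
  where
  parts : ⟦ ⋀ nf (vertexDiagram A ρA σA) ⟧⊤ B ρB σB ≡ true × ⟦ ⋀ nf (λ i → ⋀ nf (pairDiagram A ρA i)) ⟧⊤ B ρB σB ≡ true
  parts = ∧⊤-elim (⋀ nf (vertexDiagram A ρA σA)) (⋀ nf (λ i → ⋀ nf (pairDiagram A ρA i))) t
  like₁ : ∀ i → Like₁ A B σA σB (ρA i) (ρB i)
  like₁ i =
    let col-i , mem-i = ∧⊤-elim (colourAtom A ρA i) (memberships A ρA σA i)
                          (⋀-elim nf (vertexDiagram A ρA σA) (proj₁ parts) i) in
    sym (⌊≟⌋-true col-i) ,
    λ X → sym (literal-elim _ (mem i X) (⋀-elim ns (λ X → literal (σA X (ρA i)) (mem i X)) mem-i X))
  like₂ : ∀ i j → Like₂ A B (ρA i) (ρA j) (ρB i) (ρB j)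
  like₂ i j =
    let pair = ⋀-elim nf (pairDiagram A ρA i) (⋀-elim nf (λ i → ⋀ nf (pairDiagram A ρA i)) (proj₂ parts) i) j
        eq-ij , rel-ij = ∧⊤-elim (equality A ρA i j) (relations A ρA i j) pair in
    sym (literal-elim _ (eq i j) eq-ij) ,
    λ R → sym (literal-elim _ (rel R i j)
                 (⋀-elim nR (λ R → literal (edge (graph A) R (ρA i) (ρA j)) (rel R i j)) rel-ij R))

module _ (A : CGraph nR c) (next : ∀ {nf ns} → (Fin nf → Vertex A) → SetVars ns A → Formula⊤ nR c nf ns)
         (ρ : Fin nf → Vertex A) (σ : SetVars ns A) where

  forthVertex backVertex forthSet backSet : Formula⊤ nR c nf ns
  forthVertex = ⋀ (vert (graph A)) (λ v → ∃¹⊤ (next (cons v ρ) σ))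
  backVertex  = ∀¹⊤ (⋁ (vert (graph A)) (λ v → next (cons v ρ) σ))
  forthSet    = ⋀ˢ (vert (graph A)) (λ S → ∃²⊤ (next ρ (cons S σ)))
  backSet     = ∀²⊤ (⋁ˢ (vert (graph A)) (λ S → next ρ (cons S σ)))

-- The Hintikka formula of rank m: it holds in B at (ρB, σB) exactly when
-- Duplicator wins m rounds from (A, ρA, σA) against (B, ρB, σB).
hintikka : ℕ → (A : CGraph nR c) → (Fin nf → Vertex A) → SetVars ns A → Formula⊤ nR c nf ns
hintikka zero    A ρ σ = diagram A ρ σ
hintikka (suc m) A ρ σ =
  diagram A ρ σ ∧⊤ (forthVertex A next ρ σ ∧⊤ (backVertex A next ρ σ ∧⊤ (forthSet A next ρ σ ∧⊤ backSet A next ρ σ)))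
  where
  next : ∀ {nf ns} → (Fin nf → Vertex A) → SetVars ns A → Formula⊤ _ _ nf ns
  next = hintikka m A

hintikka-qr : ∀ m (A : CGraph nR c) (ρ : Fin nf → Vertex A) (σ : SetVars ns A) → qr⊤ (hintikka m A ρ σ) ≤ m
hintikka-qr zero    A ρ σ = diagram-qr A ρ σ
hintikka-qr (suc m) A ρ σ =
  ∧⊤-qr (diagram A ρ σ) _ (diagram-qr A ρ σ)
  (∧⊤-qr (forthVertex A next ρ σ) _
    (⋀-qr _ (λ v → ∃¹⊤ (next (cons v ρ) σ)) λ v → ∃¹⊤-qr (next (cons v ρ) σ) (hintikka-qr m A (cons v ρ) σ))
  (∧⊤-qr (backVertex A next ρ σ) _
    (∀¹⊤-qr (⋁ _ λ v → next (cons v ρ) σ) (⋁-qr _ (λ v → next (cons v ρ) σ) λ v → hintikka-qr m A (cons v ρ) σ))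
  (∧⊤-qr (forthSet A next ρ σ) _
    (⋀ˢ-qr _ (λ S → ∃²⊤ (next ρ (cons S σ))) λ S → ∃²⊤-qr (next ρ (cons S σ)) (hintikka-qr m A ρ (cons S σ)))
    (∀²⊤-qr (⋁ˢ _ λ S → next ρ (cons S σ)) (⋁ˢ-qr _ (λ S → next ρ (cons S σ)) λ S → hintikka-qr m A ρ (cons S σ))))))
  where
  next : ∀ {nf ns} → (Fin nf → Vertex A) → SetVars ns A → Formula⊤ _ _ nf ns
  next = hintikka m A

hintikka-self : ∀ m (A : CGraph nR c) (ρ : Fin nf → Vertex A) (σ : SetVars ns A) → ⟦ hintikka m A ρ σ ⟧⊤ A ρ σ ≡ true
hintikka-self zero    A ρ σ = diagram-self A ρ σ
hintikka-self (suc m) A ρ σ =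
  ∧⊤-intro (diagram A ρ σ) _ (diagram-self A ρ σ)
  (∧⊤-intro (forthVertex A next ρ σ) _
    (⋀-intro _ _ λ v → ∃¹⊤-intro (next (cons v ρ) σ) v (hintikka-self m A (cons v ρ) σ))
  (∧⊤-intro (backVertex A next ρ σ) _
    (∀¹⊤-intro (⋁ _ λ v → next (cons v ρ) σ) λ w → ⋁-intro _ _ w (hintikka-self m A (cons w ρ) σ))
  (∧⊤-intro (forthSet A next ρ σ) _
    (⋀ˢ-intro _ _ λ S → ∃²⊤-intro (next ρ (cons S σ)) S (hintikka-self m A ρ (cons S σ)))
    (∀²⊤-intro (⋁ˢ _ λ S → next ρ (cons S σ)) λ T → ⋁ˢ-intro _ (λ S → next ρ (cons S σ)) T λ S S≗T →
      trans (⟦⟧⊤-cong (next ρ (cons S σ)) (cons-≋ (λ v → sym (S≗T v)) ≋-refl)) (hintikka-self m A ρ (cons S σ))))))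
  where
  next : ∀ {nf ns} → (Fin nf → Vertex A) → SetVars ns A → Formula⊤ _ _ nf ns
  next = hintikka m A

hintikka-complete : ∀ m {A B : CGraph nR c} {ρA : Fin nf → Vertex A} {ρB : Fin nf → Vertex B}
                    {pA : Pebbles nf A} {pB : Pebbles nf B} {σA : SetVars ns A} {σB : SetVars ns B} →
                    ⟦ hintikka m A ρA σA ⟧⊤ B ρB σB ≡ true → Placed pA ρA → Placed pB ρB → EF A B m pA pB σA σB
hintikka-complete zero t hA hB = diagram-complete t hA hB
hintikka-complete (suc m) {A} {B} {ρA} {ρB} {σA = σA} {σB} t hA hB = game
  where
  Holds : Formula⊤ _ _ _ _ → Set
  Holds φ = ⟦ φ ⟧⊤ B ρB σB ≡ true
  next : ∀ {nf ns} → (Fin nf → Vertex A) → SetVars ns A → Formula⊤ _ _ nf ns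
  next = hintikka m A
  fV bV fS bS : Formula⊤ _ _ _ _
  fV = forthVertex A next ρA σA
  bV = backVertex A next ρA σA
  fS = forthSet A next ρA σA
  bS = backSet A next ρA σA
  t₀ : Holds (diagram A ρA σA) × Holds (fV ∧⊤ (bV ∧⊤ (fS ∧⊤ bS)))
  t₀ = ∧⊤-elim (diagram A ρA σA) _ t
  t₁ : Holds fV × Holds (bV ∧⊤ (fS ∧⊤ bS))
  t₁ = ∧⊤-elim fV _ (proj₂ t₀)
  t₂ : Holds bV × Holds (fS ∧⊤ bS)
  t₂ = ∧⊤-elim bV _ (proj₂ t₁)
  t₃ : Holds fS × Holds bS
  t₃ = ∧⊤-elim fS bS (proj₂ t₂)
  game : EF A B (suc m) _ _ σA σB
  game .atomic = diagram-complete (proj₁ t₀) hA hB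
  game .forth₁ v =
    let w , tw = ∃¹⊤-elim (next (cons v ρA) σA) (⋀-elim _ _ (proj₁ t₁) v) in
    w , hintikka-complete m tw (Placed-cons hA) (Placed-cons hB)
  game .back₁ w =
    let v , tv = ⋁-elim _ _ (∀¹⊤-elim (⋁ _ (λ v → next (cons v ρA) σA)) (proj₁ t₂) w) in
    v , hintikka-complete m tv (Placed-cons hA) (Placed-cons hB)
  game .forth₂ S =
    let S' , S'≗S , tS' = ⋀ˢ-elim _ _ (proj₁ t₃) S ; T , tT = ∃²⊤-elim (next ρA (cons S' σA)) tS' in
    T , EF-≋ m (cons-≋ S'≗S ≋-refl) (hintikka-complete m tT hA hB)
  game .back₂ T =
    let S , tS = ⋁ˢ-elim _ _ (∀²⊤-elim (⋁ˢ _ (λ S → next ρA (cons S σA))) (proj₂ t₃) T) in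
    S , hintikka-complete m tS hA hB

none : {X : Set} → Fin 0 → X
none ()

satC≡⟦⟧ : (A : CGraph nR c) (ψ : Formula nR c 0 0) → satC A ψ ≡ ⟦ ψ ⟧ A none none
satC≡⟦⟧ A ψ = sat-cong ψ (graph A) (colourPred A) (λ ()) (λ ())

EF⇒SameType : ∀ m {A B : CGraph nR c} → EF A B m none none none none → SameType m A B
EF⇒SameType m {A} {B} g ψ k =
  trans (satC≡⟦⟧ A ψ) (trans (EF-sound m ψ (λ ()) (λ ()) g k) (sym (satC≡⟦⟧ B ψ)))

SameType⇒EF : ∀ m {A B : CGraph nR c} → SameType m A B → EF A B m none none none none
SameType⇒EF m {A} {B} same =
  hintikka-complete m (transfer (hintikka m A none none) (hintikka-qr m A none none) (hintikka-self m A none none))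
    (λ ()) (λ ())
  where
  transfer : (φ : Formula⊤ _ _ 0 0) → qr⊤ φ ≤ m → ⟦ φ ⟧⊤ A none none ≡ true → ⟦ φ ⟧⊤ B none none ≡ true
  transfer nothing  _ _ = refl
  transfer (just ψ) k t = trans (sym (satC≡⟦⟧ B ψ)) (trans (sym (same ψ k)) (trans (satC≡⟦⟧ A ψ) t))

-- Compositionality of types

SameType-recolour : ∀ m {A B : CGraph nR c} (fA : Vertex A → Fin c') (fB : Vertex B → Fin c') →
                    (∀ v w → colour A v ≡ colour B w → fA v ≡ fB w) →
                    SameType m A B → SameType m (recoloured A fA) (recoloured B fB)
SameType-recolour m fA fB respects same =
  EF⇒SameType m (EF-recolour fA fB respects m (SameType⇒EF m same))

cgraphOf : CD nR c → CGraph nR c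
cgraphOf D = record { graph = graphOf D ; colour = colOf D }

module _ (M : Fin nR → Side → Fin c → Fin c → Bool) (D E : CD nR c) where

  colOf-joinˡ : ∀ {v x} → splitAt ∣ D ∣ v ≡ inj₁ x → colOf (join M D E) v ≡ colOf D x
  colOf-joinˡ v↦x rewrite v↦x = refl

  colOf-joinʳ : ∀ {v y} → splitAt ∣ D ∣ v ≡ inj₂ y → colOf (join M D E) v ≡ colOf E y
  colOf-joinʳ v↦y rewrite v↦y = refl

  edgeOf-joinˡˡ : ∀ R {u v x y} → splitAt ∣ D ∣ u ≡ inj₁ x → splitAt ∣ D ∣ v ≡ inj₁ y →
                  edgeOf (join M D E) R u v ≡ edgeOf D R x y
  edgeOf-joinˡˡ R u↦ v↦ rewrite u↦ | v↦ = refl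

  edgeOf-joinʳʳ : ∀ R {u v x y} → splitAt ∣ D ∣ u ≡ inj₂ x → splitAt ∣ D ∣ v ≡ inj₂ y →
                  edgeOf (join M D E) R u v ≡ edgeOf E R x y
  edgeOf-joinʳʳ R u↦ v↦ rewrite u↦ | v↦ = refl

  edgeOf-joinˡʳ : ∀ R {u v x y} → splitAt ∣ D ∣ u ≡ inj₁ x → splitAt ∣ D ∣ v ≡ inj₂ y →
                  edgeOf (join M D E) R u v ≡ M R right (colOf D x) (colOf E y)
  edgeOf-joinˡʳ R u↦ v↦ rewrite u↦ | v↦ = refl

  edgeOf-joinʳˡ : ∀ R {u v x y} → splitAt ∣ D ∣ u ≡ inj₂ x → splitAt ∣ D ∣ v ≡ inj₁ y →
                  edgeOf (join M D E) R u v ≡ M R left (colOf E x) (colOf D y)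
  edgeOf-joinʳˡ R u↦ v↦ rewrite u↦ | v↦ = refl

module _ {a b : ℕ} {v v' : Fin (a + b)} where

  ⌊≟⌋-splitˡˡ : ∀ {x y} → splitAt a v ≡ inj₁ x → splitAt a v' ≡ inj₁ y → ⌊ v ≟ v' ⌋ ≡ ⌊ x ≟ y ⌋
  ⌊≟⌋-splitˡˡ v↦ v'↦ = ⌊≟⌋-cong
    (λ v≡v' → inj₁-injective (trans (sym v↦) (trans (cong (splitAt a) v≡v') v'↦)))
    (λ x≡y → trans (sym (splitAt⁻¹-↑ˡ v↦)) (trans (cong (_↑ˡ b) x≡y) (splitAt⁻¹-↑ˡ v'↦)))

  ⌊≟⌋-splitʳʳ : ∀ {x y} → splitAt a v ≡ inj₂ x → splitAt a v' ≡ inj₂ y → ⌊ v ≟ v' ⌋ ≡ ⌊ x ≟ y ⌋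
  ⌊≟⌋-splitʳʳ v↦ v'↦ = ⌊≟⌋-cong
    (λ v≡v' → inj₂-injective (trans (sym v↦) (trans (cong (splitAt a) v≡v') v'↦)))
    (λ x≡y → trans (sym (splitAt⁻¹-↑ʳ v↦)) (trans (cong (a ↑ʳ_) x≡y) (splitAt⁻¹-↑ʳ v'↦)))

  ⌊≟⌋-splitˡʳ : ∀ {x y} → splitAt a v ≡ inj₁ x → splitAt a v' ≡ inj₂ y → ⌊ v ≟ v' ⌋ ≡ false
  ⌊≟⌋-splitˡʳ v↦ v'↦ with v ≟ v'
  ... | no _       = refl
  ... | yes refl with trans (sym v↦) v'↦
  ...   | ()

  ⌊≟⌋-splitʳˡ : ∀ {x y} → splitAt a v ≡ inj₂ x → splitAt a v' ≡ inj₁ y → ⌊ v ≟ v' ⌋ ≡ false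
  ⌊≟⌋-splitʳˡ v↦ v'↦ with v ≟ v'
  ... | no _       = refl
  ... | yes refl with trans (sym v↦) v'↦
  ...   | ()

-- xL and xR are the restrictions of a pebble x of a joined graph to its two parts.
SplitsAs : ∀ a {b} → Maybe (Fin (a + b)) → Maybe (Fin a) → Maybe (Fin b) → Set
SplitsAs a nothing  xL xR = xL ≡ nothing × xR ≡ nothing
SplitsAs a (just v) xL xR = [ (λ x → xL ≡ just x × xR ≡ nothing) , (λ y → xL ≡ nothing × xR ≡ just y) ]′ (splitAt a v)

SplitsAs-left : ∀ {a b} {v : Fin (a + b)} {x} → splitAt a v ≡ inj₁ x → SplitsAs a (just v) (just x) nothing
SplitsAs-left v↦x rewrite v↦x = refl , refl

SplitsAs-right : ∀ {a b} {v : Fin (a + b)} {y} → splitAt a v ≡ inj₂ y → SplitsAs a (just v) nothing (just y)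
SplitsAs-right v↦y rewrite v↦y = refl , refl

SetsSplit : ∀ a {b} → (Fin ns → Fin (a + b) → Bool) → (Fin ns → Fin a → Bool) → (Fin ns → Fin b → Bool) → Set
SetsSplit a σ τL τR = ∀ X v → σ X v ≡ [ τL X , τR X ]′ (splitAt a v)

SetsSplit-cons : ∀ a {b} {σ : Fin ns → Fin (a + b) → Bool} {τL τR} {S SL SR} →
                 (∀ v → S v ≡ [ SL , SR ]′ (splitAt a v)) → SetsSplit a σ τL τR →
                 SetsSplit a (cons S σ) (cons SL τL) (cons SR τR)
SetsSplit-cons a S-split σ-split zero    = S-split
SetsSplit-cons a S-split σ-split (suc X) = σ-split X

split-η : ∀ a {b} (S : Fin (a + b) → Bool) v → S v ≡ [ S ∘ (_↑ˡ b) , S ∘ (a ↑ʳ_) ]′ (splitAt a v)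
split-η a {b} S v = trans (cong S (sym (join-splitAt a b v))) ([,]-∘ S (splitAt a v))

module JoinGame (M : Fin nR → Side → Fin c → Fin c → Bool) (D₁ E₁ D₂ E₂ : CD nR c) where

  J₁ J₂ L₁ L₂ R₁ R₂ : CGraph nR c
  J₁ = cgraphOf (join M D₁ E₁)
  J₂ = cgraphOf (join M D₂ E₂)
  L₁ = cgraphOf D₁
  L₂ = cgraphOf D₂
  R₁ = cgraphOf E₁
  R₂ = cgraphOf E₂

  module Atomic {nf ns} {ρ₁ : Pebbles nf J₁} {ρ₂ : Pebbles nf J₂} {σ₁ : SetVars ns J₁} {σ₂ : SetVars ns J₂}
                {pL₁ : Pebbles nf L₁} {pR₁ : Pebbles nf R₁} {pL₂ : Pebbles nf L₂} {pR₂ : Pebbles nf R₂}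
                {τL₁ : SetVars ns L₁} {τR₁ : SetVars ns R₁} {τL₂ : SetVars ns L₂} {τR₂ : SetVars ns R₂}
                (split₁ : ∀ i → SplitsAs ∣ D₁ ∣ (ρ₁ i) (pL₁ i) (pR₁ i))
                (split₂ : ∀ i → SplitsAs ∣ D₂ ∣ (ρ₂ i) (pL₂ i) (pR₂ i))
                (sets₁ : SetsSplit ∣ D₁ ∣ σ₁ τL₁ τR₁) (sets₂ : SetsSplit ∣ D₂ ∣ σ₂ τL₂ τR₂)
                (agreeL : AtomicAgree L₁ L₂ pL₁ pL₂ τL₁ τL₂) (agreeR : AtomicAgree R₁ R₂ pR₁ pR₂ τR₁ τR₂) where

    data Sides (x₁ : Maybe (Vertex J₁)) (x₂ : Maybe (Vertex J₂))
               (l₁ : Maybe (Vertex L₁)) (r₁ : Maybe (Vertex R₁))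
               (l₂ : Maybe (Vertex L₂)) (r₂ : Maybe (Vertex R₂)) : Set where
      unplaced : x₁ ≡ nothing → x₂ ≡ nothing → Sides x₁ x₂ l₁ r₁ l₂ r₂
      onLeft   : ∀ {v w x x'} → x₁ ≡ just v → x₂ ≡ just w → splitAt ∣ D₁ ∣ v ≡ inj₁ x → splitAt ∣ D₂ ∣ w ≡ inj₁ x' →
                 l₁ ≡ just x → l₂ ≡ just x' → Like₁ L₁ L₂ τL₁ τL₂ x x' → Sides x₁ x₂ l₁ r₁ l₂ r₂
      onRight  : ∀ {v w y y'} → x₁ ≡ just v → x₂ ≡ just w → splitAt ∣ D₁ ∣ v ≡ inj₂ y → splitAt ∣ D₂ ∣ w ≡ inj₂ y' →
                 r₁ ≡ just y → r₂ ≡ just y' → Like₁ R₁ R₂ τR₁ τR₂ y y' → Sides x₁ x₂ l₁ r₁ l₂ r₂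

    sides-of : ∀ x₁ x₂ {l₁ r₁ l₂ r₂} → SplitsAs ∣ D₁ ∣ x₁ l₁ r₁ → SplitsAs ∣ D₂ ∣ x₂ l₂ r₂ →
               Agree₁ L₁ L₂ τL₁ τL₂ l₁ l₂ → Agree₁ R₁ R₂ τR₁ τR₂ r₁ r₂ → Sides x₁ x₂ l₁ r₁ l₂ r₂
    sides-of nothing  nothing  _ _ _ _ = unplaced refl refl
    sides-of nothing  (just w) s₁ s₂ aL aR with splitAt ∣ D₂ ∣ w
    ... | inj₁ _ = ⊥-elim (Agree₁-nothing-just (proj₁ s₁) (proj₁ s₂) aL)
    ... | inj₂ _ = ⊥-elim (Agree₁-nothing-just (proj₂ s₁) (proj₂ s₂) aR)
    sides-of (just v) nothing  s₁ s₂ aL aR with splitAt ∣ D₁ ∣ v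
    ... | inj₁ _ = ⊥-elim (Agree₁-just-nothing (proj₁ s₁) (proj₁ s₂) aL)
    ... | inj₂ _ = ⊥-elim (Agree₁-just-nothing (proj₂ s₁) (proj₂ s₂) aR)
    sides-of (just v) (just w) s₁ s₂ aL aR with splitAt ∣ D₁ ∣ v in v↦ | splitAt ∣ D₂ ∣ w in w↦
    ... | inj₁ _ | inj₁ _ = onLeft refl refl v↦ w↦ (proj₁ s₁) (proj₁ s₂) (Agree₁-just (proj₁ s₁) (proj₁ s₂) aL)
    ... | inj₁ _ | inj₂ _ = ⊥-elim (Agree₁-just-nothing (proj₁ s₁) (proj₁ s₂) aL)
    ... | inj₂ _ | inj₁ _ = ⊥-elim (Agree₁-nothing-just (proj₁ s₁) (proj₁ s₂) aL)
    ... | inj₂ _ | inj₂ _ = onRight refl refl v↦ w↦ (proj₂ s₁) (proj₂ s₂) (Agree₁-just (proj₂ s₁) (proj₂ s₂) aR)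

    sides : ∀ i → Sides (ρ₁ i) (ρ₂ i) (pL₁ i) (pR₁ i) (pL₂ i) (pR₂ i)
    sides i = sides-of (ρ₁ i) (ρ₂ i) (split₁ i) (split₂ i) (proj₁ agreeL i) (proj₁ agreeR i)

    like-left : ∀ {v w x x'} → splitAt ∣ D₁ ∣ v ≡ inj₁ x → splitAt ∣ D₂ ∣ w ≡ inj₁ x' →
                Like₁ L₁ L₂ τL₁ τL₂ x x' → Like₁ J₁ J₂ σ₁ σ₂ v w
    like-left {v} {w} v↦ w↦ (same , sameSets) =
      trans (colOf-joinˡ M D₁ E₁ v↦) (trans same (sym (colOf-joinˡ M D₂ E₂ w↦))) ,
      λ X → trans (trans (sets₁ X v) (cong [ τL₁ X , τR₁ X ]′ v↦))
                  (trans (sameSets X) (sym (trans (sets₂ X w) (cong [ τL₂ X , τR₂ X ]′ w↦))))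

    like-right : ∀ {v w y y'} → splitAt ∣ D₁ ∣ v ≡ inj₂ y → splitAt ∣ D₂ ∣ w ≡ inj₂ y' →
                 Like₁ R₁ R₂ τR₁ τR₂ y y' → Like₁ J₁ J₂ σ₁ σ₂ v w
    like-right {v} {w} v↦ w↦ (same , sameSets) =
      trans (colOf-joinʳ M D₁ E₁ v↦) (trans same (sym (colOf-joinʳ M D₂ E₂ w↦))) ,
      λ X → trans (trans (sets₁ X v) (cong [ τL₁ X , τR₁ X ]′ v↦))
                  (trans (sameSets X) (sym (trans (sets₂ X w) (cong [ τL₂ X , τR₂ X ]′ w↦))))

    agree₁ : ∀ i → Agree₁ J₁ J₂ σ₁ σ₂ (ρ₁ i) (ρ₂ i)
    agree₁ i with sides i
    ... | unplaced e₁ e₂ = subst₂ (Agree₁ J₁ J₂ σ₁ σ₂) (sym e₁) (sym e₂) tt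
    ... | onLeft e₁ e₂ v↦ w↦ _ _ like = subst₂ (Agree₁ J₁ J₂ σ₁ σ₂) (sym e₁) (sym e₂) (like-left v↦ w↦ like)
    ... | onRight e₁ e₂ v↦ w↦ _ _ like = subst₂ (Agree₁ J₁ J₂ σ₁ σ₂) (sym e₁) (sym e₂) (like-right v↦ w↦ like)

    agree₂ : ∀ i j → Agree₂ J₁ J₂ (ρ₁ i) (ρ₁ j) (ρ₂ i) (ρ₂ j)
    agree₂ i j with sides i | sides j
    ... | unplaced e₁ e₂ | _ = Agree₂-subst (sym e₁) refl (sym e₂) refl tt
    ... | onLeft e₁ e₂ _ _ _ _ _ | unplaced f₁ f₂ = Agree₂-subst (sym e₁) (sym f₁) (sym e₂) (sym f₂) tt
    ... | onRight e₁ e₂ _ _ _ _ _ | unplaced f₁ f₂ = Agree₂-subst (sym e₁) (sym f₁) (sym e₂) (sym f₂) tt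
    ... | onLeft e₁ e₂ v↦ w↦ l₁ l₂ _ | onLeft f₁ f₂ v'↦ w'↦ l₁' l₂' _ =
      let eqs , edges = Agree₂-just l₁ l₁' l₂ l₂' (proj₂ agreeL i j) in
      Agree₂-subst (sym e₁) (sym f₁) (sym e₂) (sym f₂)
        (trans (⌊≟⌋-splitˡˡ v↦ v'↦) (trans eqs (sym (⌊≟⌋-splitˡˡ w↦ w'↦))) ,
         λ R → trans (edgeOf-joinˡˡ M D₁ E₁ R v↦ v'↦) (trans (edges R) (sym (edgeOf-joinˡˡ M D₂ E₂ R w↦ w'↦))))
    ... | onRight e₁ e₂ v↦ w↦ r₁ r₂ _ | onRight f₁ f₂ v'↦ w'↦ r₁' r₂' _ =
      let eqs , edges = Agree₂-just r₁ r₁' r₂ r₂' (proj₂ agreeR i j) in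
      Agree₂-subst (sym e₁) (sym f₁) (sym e₂) (sym f₂)
        (trans (⌊≟⌋-splitʳʳ v↦ v'↦) (trans eqs (sym (⌊≟⌋-splitʳʳ w↦ w'↦))) ,
         λ R → trans (edgeOf-joinʳʳ M D₁ E₁ R v↦ v'↦) (trans (edges R) (sym (edgeOf-joinʳʳ M D₂ E₂ R w↦ w'↦))))
    ... | onLeft e₁ e₂ v↦ w↦ _ _ like | onRight f₁ f₂ v'↦ w'↦ _ _ like' =
      Agree₂-subst (sym e₁) (sym f₁) (sym e₂) (sym f₂)
        (trans (⌊≟⌋-splitˡʳ v↦ v'↦) (sym (⌊≟⌋-splitˡʳ w↦ w'↦)) ,
         λ R → trans (edgeOf-joinˡʳ M D₁ E₁ R v↦ v'↦)
                 (trans (cong₂ (M R right) (proj₁ like) (proj₁ like')) (sym (edgeOf-joinˡʳ M D₂ E₂ R w↦ w'↦))))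
    ... | onRight e₁ e₂ v↦ w↦ _ _ like | onLeft f₁ f₂ v'↦ w'↦ _ _ like' =
      Agree₂-subst (sym e₁) (sym f₁) (sym e₂) (sym f₂)
        (trans (⌊≟⌋-splitʳˡ v↦ v'↦) (sym (⌊≟⌋-splitʳˡ w↦ w'↦)) ,
         λ R → trans (edgeOf-joinʳˡ M D₁ E₁ R v↦ v'↦)
                 (trans (cong₂ (M R left) (proj₁ like) (proj₁ like')) (sym (edgeOf-joinʳˡ M D₂ E₂ R w↦ w'↦))))

    AtomicAgree-join : AtomicAgree J₁ J₂ ρ₁ ρ₂ σ₁ σ₂
    AtomicAgree-join = agree₁ , agree₂

  SplitsAs-cons : ∀ {a b} {ρ : Fin nf → Maybe (Fin (a + b))} {pL pR} {x xL xR} →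
                  SplitsAs a x xL xR → (∀ i → SplitsAs a (ρ i) (pL i) (pR i)) →
                  ∀ i → SplitsAs a (cons x ρ i) (cons xL pL i) (cons xR pR i)
  SplitsAs-cons x-split ρ-split zero    = x-split
  SplitsAs-cons x-split ρ-split (suc i) = ρ-split i

  EF-join : ∀ m {nf ns} {ρ₁ : Pebbles nf J₁} {ρ₂ : Pebbles nf J₂} {σ₁ : SetVars ns J₁} {σ₂ : SetVars ns J₂}
            {pL₁ : Pebbles nf L₁} {pR₁ : Pebbles nf R₁} {pL₂ : Pebbles nf L₂} {pR₂ : Pebbles nf R₂}
            {τL₁ : SetVars ns L₁} {τR₁ : SetVars ns R₁} {τL₂ : SetVars ns L₂} {τR₂ : SetVars ns R₂} →
            (∀ i → SplitsAs ∣ D₁ ∣ (ρ₁ i) (pL₁ i) (pR₁ i)) → (∀ i → SplitsAs ∣ D₂ ∣ (ρ₂ i) (pL₂ i) (pR₂ i)) →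
            SetsSplit ∣ D₁ ∣ σ₁ τL₁ τR₁ → SetsSplit ∣ D₂ ∣ σ₂ τL₂ τR₂ →
            EF L₁ L₂ m pL₁ pL₂ τL₁ τL₂ → EF R₁ R₂ m pR₁ pR₂ τR₁ τR₂ → EF J₁ J₂ m ρ₁ ρ₂ σ₁ σ₂
  EF-join zero split₁ split₂ sets₁ sets₂ gL gR = Atomic.AtomicAgree-join split₁ split₂ sets₁ sets₂ gL gR
  EF-join (suc m) split₁ split₂ sets₁ sets₂ gL gR .atomic =
    Atomic.AtomicAgree-join split₁ split₂ sets₁ sets₂ (atomic gL) (atomic gR)
  EF-join (suc m) split₁ split₂ sets₁ sets₂ gL gR .forth₁ v with splitAt ∣ D₁ ∣ v in v↦
  ... | inj₁ x = let x' , gL' = forth₁ gL x in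
    x' ↑ˡ ∣ E₂ ∣ ,
    EF-join m (SplitsAs-cons (SplitsAs-left v↦) split₁)
              (SplitsAs-cons (SplitsAs-left (splitAt-↑ˡ (∣ D₂ ∣) x' (∣ E₂ ∣))) split₂)
              sets₁ sets₂ gL' (EF-reindex m Reindexing-unplaced (EF-weaken m gR))
  ... | inj₂ y = let y' , gR' = forth₁ gR y in
    ∣ D₂ ∣ ↑ʳ y' ,
    EF-join m (SplitsAs-cons (SplitsAs-right v↦) split₁)
              (SplitsAs-cons (SplitsAs-right (splitAt-↑ʳ (∣ D₂ ∣) (∣ E₂ ∣) y')) split₂)
              sets₁ sets₂ (EF-reindex m Reindexing-unplaced (EF-weaken m gL)) gR'
  EF-join (suc m) split₁ split₂ sets₁ sets₂ gL gR .back₁ w with splitAt ∣ D₂ ∣ w in w↦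
  ... | inj₁ x' = let x , gL' = back₁ gL x' in
    x ↑ˡ ∣ E₁ ∣ ,
    EF-join m (SplitsAs-cons (SplitsAs-left (splitAt-↑ˡ (∣ D₁ ∣) x (∣ E₁ ∣))) split₁)
              (SplitsAs-cons (SplitsAs-left w↦) split₂)
              sets₁ sets₂ gL' (EF-reindex m Reindexing-unplaced (EF-weaken m gR))
  ... | inj₂ y' = let y , gR' = back₁ gR y' in
    ∣ D₁ ∣ ↑ʳ y ,
    EF-join m (SplitsAs-cons (SplitsAs-right (splitAt-↑ʳ (∣ D₁ ∣) (∣ E₁ ∣) y)) split₁)
              (SplitsAs-cons (SplitsAs-right w↦) split₂)
              sets₁ sets₂ (EF-reindex m Reindexing-unplaced (EF-weaken m gL)) gR'
  EF-join (suc m) split₁ split₂ sets₁ sets₂ gL gR .forth₂ S =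
    let SL' , gL' = forth₂ gL (S ∘ (_↑ˡ ∣ E₁ ∣))
        SR' , gR' = forth₂ gR (S ∘ (∣ D₁ ∣ ↑ʳ_)) in
    (λ w → [ SL' , SR' ]′ (splitAt ∣ D₂ ∣ w)) ,
    EF-join m split₁ split₂
      (SetsSplit-cons (∣ D₁ ∣) (split-η (∣ D₁ ∣) S) sets₁) (SetsSplit-cons (∣ D₂ ∣) (λ _ → refl) sets₂) gL' gR'
  EF-join (suc m) split₁ split₂ sets₁ sets₂ gL gR .back₂ S' =
    let SL , gL' = back₂ gL (S' ∘ (_↑ˡ ∣ E₂ ∣))
        SR , gR' = back₂ gR (S' ∘ (∣ D₂ ∣ ↑ʳ_)) in
    (λ v → [ SL , SR ]′ (splitAt ∣ D₁ ∣ v)) ,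
    EF-join m split₁ split₂
      (SetsSplit-cons (∣ D₁ ∣) (λ _ → refl) sets₁) (SetsSplit-cons (∣ D₂ ∣) (split-η (∣ D₂ ∣) S') sets₂) gL' gR'

SameType-join : ∀ m (M : Fin nR → Side → Fin c → Fin c → Bool) {D₁ E₁ D₂ E₂ : CD nR c} →
                SameType m (cgraphOf D₁) (cgraphOf D₂) → SameType m (cgraphOf E₁) (cgraphOf E₂) →
                SameType m (cgraphOf (join M D₁ E₁)) (cgraphOf (join M D₂ E₂))
SameType-join m M {D₁} {E₁} {D₂} {E₂} sameL sameR =
  EF⇒SameType m (JoinGame.EF-join M D₁ E₁ D₂ E₂ m (λ ()) (λ ()) (λ ()) (λ ())
                   (SameType⇒EF m sameL) (SameType⇒EF m sameR))

SameType-sym : ∀ m {A B : CGraph nR c} → SameType m A B → SameType m B A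
SameType-sym m same ψ k = sym (same ψ k)

SameType-trans : ∀ m {A B C : CGraph nR c} → SameType m A B → SameType m B C → SameType m A C
SameType-trans m same same' ψ k = trans (same ψ k) (same' ψ k)

SameType-▷ : ∀ m (C : CD nR c) {X Y : CD nR c} →
             SameType m (cgraphOf X) (cgraphOf Y) → SameType m (cgraphOf (C ▷ X)) (cgraphOf (C ▷ Y))
SameType-▷ m (constant a R) same ψ k = refl
SameType-▷ m hole           same = same
SameType-▷ m (recolor g C) {X} {Y} same =
  SameType-recolour m (g ∘ colOf (C ▷ X)) (g ∘ colOf (C ▷ Y)) (λ v w → cong g) (SameType-▷ m C same)
SameType-▷ m (join M C C') {X} {Y} same =
  SameType-join m M {C ▷ X} {C' ▷ X} {C ▷ Y} {C' ▷ Y} (SameType-▷ m C same) (SameType-▷ m C' same)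

liftFormula : Formula nR 0 nf ns → Formula nR c nf ns
liftFormula (eq x y)    = eq x y
liftFormula (rel R x y) = rel R x y
liftFormula (col () x)
liftFormula (mem x X)   = mem x X
liftFormula (neg ψ)     = neg (liftFormula ψ)
liftFormula (and ψ χ)   = and (liftFormula ψ) (liftFormula χ)
liftFormula (ex1 ψ)     = ex1 (liftFormula ψ)
liftFormula (ex2 ψ)     = ex2 (liftFormula ψ)

liftFormula-qr : (ψ : Formula nR 0 nf ns) → qr (liftFormula {c = c} ψ) ≡ qr ψ
liftFormula-qr (eq x y)    = refl
liftFormula-qr (rel R x y) = refl
liftFormula-qr (col () x)
liftFormula-qr (mem x X)   = refl
liftFormula-qr (neg ψ)     = liftFormula-qr ψ
liftFormula-qr {c = c} (and ψ χ) = cong₂ _⊔_ (liftFormula-qr {c = c} ψ) (liftFormula-qr {c = c} χ)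
liftFormula-qr {c = c} (ex1 ψ)   = cong suc (liftFormula-qr {c = c} ψ)
liftFormula-qr {c = c} (ex2 ψ)   = cong suc (liftFormula-qr {c = c} ψ)

liftFormula-sat : (ψ : Formula nR 0 nf ns) (G : Graph nR) (P : Fin c → Fin (vert G) → Bool) (Q : Fin 0 → Fin (vert G) → Bool)
                  (ρ : Fin nf → Fin (vert G)) (σ : Fin ns → Fin (vert G) → Bool) →
                  sat (liftFormula ψ) G P ρ σ ≡ sat ψ G Q ρ σ
liftFormula-sat (eq x y)    G P Q ρ σ = refl
liftFormula-sat (rel R x y) G P Q ρ σ = refl
liftFormula-sat (col () x)  G P Q ρ σ
liftFormula-sat (mem x X)   G P Q ρ σ = refl
liftFormula-sat (neg ψ)     G P Q ρ σ = cong not (liftFormula-sat ψ G P Q ρ σ)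
liftFormula-sat (and ψ χ)   G P Q ρ σ = cong₂ _∧_ (liftFormula-sat ψ G P Q ρ σ) (liftFormula-sat χ G P Q ρ σ)
liftFormula-sat (ex1 ψ)     G P Q ρ σ = anyFin-cong λ v → liftFormula-sat ψ G P Q (cons v ρ) σ
liftFormula-sat (ex2 ψ)     G P Q ρ σ = anySubset-cong λ S → liftFormula-sat ψ G P Q ρ (cons S σ)

⊨-transfer : ∀ m {A B : CGraph nR c} (φ : Formula nR 0 0 0) → qr φ ≤ m → SameType m A B →
             graph A ⊨ φ → graph B ⊨ φ
⊨-transfer m {A} {B} φ k same Aφ =
  trans (⊨≡satC B) (trans (sym (same (liftFormula φ) (≤-trans (≤-reflexive (liftFormula-qr φ)) k)))
                          (trans (sym (⊨≡satC A)) Aφ))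
  where
  -- _⊨_ and satC evaluate with different empty assignments, equal only pointwise.
  ⊨≡satC : (C : CGraph _ _) → sat φ (graph C) _ _ _ ≡ satC C (liftFormula φ)
  ⊨≡satC C = trans (sat-cong φ (graph C) _ (λ ()) (λ ())) (sym (liftFormula-sat φ (graph C) (colourPred C) _ _ _))

uncoloured : Graph nR → CGraph nR 1
uncoloured G = record { graph = G ; colour = λ _ → zero }

⊨-iso : {G H : Graph nR} (φ : Formula nR 0 0 0) → Iso G H → H ⊨ φ → G ⊨ φ
⊨-iso {G = G} {H} φ (f , edges) =
  ⊨-transfer (qr φ) φ ≤-refl
    (SameType-sym (qr φ) (EF⇒SameType (qr φ) (EF-iso {A = uncoloured G} {B = uncoloured H} f edges (λ _ → refl)
                                                (qr φ) (λ ()) (λ ()))))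

-- Gluing and chains of contexts

▷-assoc : (C C' X : CD nR c) → (C ▷ C') ▷ X ≡ C ▷ (C' ▷ X)
▷-assoc (constant a R) C' X = refl
▷-assoc hole           C' X = refl
▷-assoc (recolor g C)  C' X = cong (recolor g) (▷-assoc C C' X)
▷-assoc (join M C C'') C' X = cong₂ (join M) (▷-assoc C C' X) (▷-assoc C'' C' X)

▷-holeless : (C X : CD nR c) → holes C ≡ 0 → C ▷ X ≡ C
▷-holeless (constant a R) X _  = refl
▷-holeless hole           X ()
▷-holeless (recolor g C)  X h  = cong (recolor g) (▷-holeless C X h)
▷-holeless (join M C C')  X h  =
  cong₂ (join M) (▷-holeless C X (m+n≡0⇒m≡0 (holes C) h)) (▷-holeless C' X (m+n≡0⇒n≡0 (holes C) h))

holes-▷ : (C X : CD nR c) → holes (C ▷ X) ≡ holes C * holes X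
holes-▷ (constant a R) X = refl
holes-▷ hole           X = sym (+-identityʳ (holes X))
holes-▷ (recolor g C)  X = holes-▷ C X
holes-▷ (join M C C')  X =
  trans (cong₂ _+_ (holes-▷ C X) (holes-▷ C' X)) (sym (*-distribʳ-+ (holes X) (holes C) (holes C')))

∣∣-▷ : (C X : CD nR c) → ∣ C ∣ ≤ ∣ C ▷ X ∣
∣∣-▷ (constant a R) X = ≤-refl
∣∣-▷ hole           X = z≤n
∣∣-▷ (recolor g C)  X = ∣∣-▷ C X
∣∣-▷ (join M C C')  X = +-mono-≤ (∣∣-▷ C X) (∣∣-▷ C' X)

holeless-nonempty : (D : CD nR c) → holes D ≡ 0 → 1 ≤ ∣ D ∣
holeless-nonempty (constant a R) _  = s≤s z≤n
holeless-nonempty hole           ()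
holeless-nonempty (recolor g D)  h  = holeless-nonempty D h
holeless-nonempty (join M D D')  h  = ≤-trans (holeless-nonempty D (m+n≡0⇒m≡0 (holes D) h)) (m≤m+n _ _)

NonemptyContext : CD nR c → Set
NonemptyContext C = holes C ≡ 1 × 1 ≤ ∣ C ∣

glue : List (CD nR c) → CD nR c → CD nR c
glue Cs X = foldr _▷_ X Cs

context : List (CD nR c) → CD nR c
context Cs = glue Cs hole

glue≡context▷ : (Cs : List (CD nR c)) (X : CD nR c) → glue Cs X ≡ context Cs ▷ X
glue≡context▷ []       X = refl
glue≡context▷ (C ∷ Cs) X = trans (cong (C ▷_) (glue≡context▷ Cs X)) (sym (▷-assoc C (context Cs) X))

glue-drop : ∀ i d (Cs : List (CD nR c)) (X : CD nR c) →
            glue (drop i Cs) X ≡ context (take d (drop i Cs)) ▷ glue (drop (i + d) Cs) X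
glue-drop i d Cs X = begin
  glue (drop i Cs) X
    ≡⟨ cong (λ Ds → glue Ds X) (take++drop≡id d (drop i Cs)) ⟨
  glue (take d (drop i Cs) ++ drop d (drop i Cs)) X
    ≡⟨ foldr-++ _▷_ X (take d (drop i Cs)) _ ⟩
  glue (take d (drop i Cs)) (glue (drop d (drop i Cs)) X)
    ≡⟨ glue≡context▷ (take d (drop i Cs)) _ ⟩
  context (take d (drop i Cs)) ▷ glue (drop d (drop i Cs)) X
    ≡⟨ cong (λ Ds → context (take d (drop i Cs)) ▷ glue Ds X) (drop-drop i d Cs) ⟩
  context (take d (drop i Cs)) ▷ glue (drop (i + d) Cs) X
    ∎
  where open ≡-Reasoning

holes-context : {Cs : List (CD nR c)} → All (λ C → holes C ≡ 1) Cs → holes (context Cs) ≡ 1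
holes-context []                      = refl
holes-context {Cs = C ∷ Cs} (h ∷ hs) = trans (holes-▷ C (context Cs)) (cong₂ _*_ h (holes-context hs))

context-nonempty : ∀ d {Cs : List (CD nR c)} → All NonemptyContext Cs → 0 < length Cs →
                   1 ≤ ∣ context (take (suc d) Cs) ∣
context-nonempty d {C ∷ Cs} ((_ , nonempty) ∷ _) _ = ≤-trans nonempty (∣∣-▷ C (context (take d Cs)))

-- At each join, one child has more than 2^j leaves; descending into it peels off
-- a one-hole context whose other child is nonempty.
chain : ∀ j (D : CD nR c) → holes D ≡ 0 → 2 ^ j < ∣ D ∣ →
        Σ (List (CD nR c)) λ Cs → Σ (CD nR c) λ B → length Cs ≡ j × All NonemptyContext Cs × D ≡ glue Cs B
chain zero    D              _  _   = [] , D , refl , [] , refl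
chain (suc j) (constant a R) _  big = ⊥-elim (<⇒≱ (m^n>0 2 (suc j)) (≤-pred big))
chain (suc j) hole           () big
chain (suc j) (recolor g D)  h  big with chain (suc j) D h big
... | C ∷ Cs , B , len , nC ∷ nCs , D≡ = recolor g C ∷ Cs , B , len , nC ∷ nCs , cong (recolor g) D≡
chain (suc j) (join M D D')  h  big with 2 ^ j <? ∣ D ∣ | 2 ^ j <? ∣ D' ∣
... | yes bigD | _ =
  let hD = m+n≡0⇒m≡0 (holes D) h ; hD' = m+n≡0⇒n≡0 (holes D) h ; Cs , B , len , nCs , D≡ = chain j D hD bigD in
  join M hole D' ∷ Cs , B , cong suc len , (cong suc hD' , holeless-nonempty D' hD') ∷ nCs ,
  cong₂ (join M) D≡ (sym (▷-holeless D' (glue Cs B) hD'))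
... | no _ | yes bigD' =
  let hD = m+n≡0⇒m≡0 (holes D) h ; hD' = m+n≡0⇒n≡0 (holes D) h ; Cs , B , len , nCs , D'≡ = chain j D' hD' bigD' in
  join M D hole ∷ Cs , B , cong suc len , (cong (_+ 1) hD , ≤-trans (holeless-nonempty D hD) (m≤m+n _ _)) ∷ nCs ,
  cong₂ (join M) (sym (▷-holeless D (glue Cs B) hD)) D'≡
... | no smallD | no smallD' =
  ⊥-elim (<⇒≱ big (≤-trans (+-mono-≤ (≮⇒≥ smallD) (≮⇒≥ smallD'))
                           (≤-reflexive (cong (2 ^ j +_) (sym (+-identityʳ (2 ^ j)))))))

record UsedIn (X D : CD nR c) : Set where
  constructor usedIn
  field used : ∀ b → usedColour X b ≡ true → usedColour D b ≡ true

UsedIn-trans : {X Y Z : CD nR c} → UsedIn X Y → UsedIn Y Z → UsedIn X Z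
UsedIn-trans (usedIn X⊑Y) (usedIn Y⊑Z) = usedIn λ b → Y⊑Z b ∘ X⊑Y b

UsedIn-≡ : {X Y : CD nR c} → X ≡ Y → UsedIn X Y
UsedIn-≡ refl = usedIn λ b used → used

countFin-mono : (p q : Fin n → Bool) → (∀ i → p i ≡ true → q i ≡ true) → countFin n p ≤ countFin n q
countFin-mono {zero}  p q p⇒q = z≤n
countFin-mono {suc n} p q p⇒q with p zero in p₀ | q zero in q₀
... | true  | true  = s≤s (countFin-mono (p ∘ suc) (q ∘ suc) (p⇒q ∘ suc))
... | true  | false = ⊥-elim (true≢false (trans (sym (p⇒q zero p₀)) q₀))
... | false | true  = m≤n⇒m≤1+n (countFin-mono (p ∘ suc) (q ∘ suc) (p⇒q ∘ suc))
... | false | false = countFin-mono (p ∘ suc) (q ∘ suc) (p⇒q ∘ suc)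

width-mono : {X D : CD nR c} → UsedIn X D → width X ≤ width D
width-mono {X = X} {D} (usedIn X⊑D) = countFin-mono (usedColour X) (usedColour D) X⊑D

present-used : (X : CD nR c) (b : Fin c) → present X b ≡ true → usedColour X b ≡ true
present-used (constant a R) b t = t
present-used hole           b ()
present-used (recolor g X)  b t = ∨-true⁺ˡ t
present-used (join M X Y)   b t = ∨-true⁺ˡ t

colOf-used : (X : CD nR c) (v : Fin ∣ X ∣) → usedColour X (colOf X v) ≡ true
colOf-used X v = present-used X _ (anyFin-intro _ v (⌊≟⌋-refl (colOf X v)))

vertex-▷ : (C X : CD nR c) (v : Fin ∣ C ∣) → Σ (Fin ∣ C ▷ X ∣) λ w → colOf (C ▷ X) w ≡ colOf C v
vertex-▷ (constant a R) X v = v , refl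
vertex-▷ hole           X ()
vertex-▷ (recolor g C)  X v = let w , same = vertex-▷ C X v in w , cong g same
vertex-▷ (join M C C')  X v with splitAt ∣ C ∣ v
... | inj₁ x = let w , same = vertex-▷ C X x in
  w ↑ˡ ∣ C' ▷ X ∣ ,
  trans (colOf-joinˡ M (C ▷ X) (C' ▷ X) (splitAt-↑ˡ (∣ C ▷ X ∣) w (∣ C' ▷ X ∣))) same
... | inj₂ y = let w , same = vertex-▷ C' X y in
  ∣ C ▷ X ∣ ↑ʳ w ,
  trans (colOf-joinʳ M (C ▷ X) (C' ▷ X) (splitAt-↑ʳ (∣ C ▷ X ∣) (∣ C' ▷ X ∣) w)) same

present-▷ : (C X : CD nR c) (b : Fin c) → present C b ≡ true → present (C ▷ X) b ≡ true
present-▷ C X b t =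
  let v , v-b = anyFin-witness _ t ; w , same = vertex-▷ C X v in
  anyFin-intro _ w (trans (cong (λ a → ⌊ a ≟ b ⌋) same) v-b)

usedColour-▷ˡ : (C X : CD nR c) (b : Fin c) → usedColour C b ≡ true → usedColour (C ▷ X) b ≡ true
usedColour-▷ˡ (constant a R) X b t = t
usedColour-▷ˡ hole           X b ()
usedColour-▷ˡ (recolor g C)  X b t with ∨-true⁻ {present (recolor g C) b} t
... | inj₁ p = ∨-true⁺ˡ (present-▷ (recolor g C) X b p)
... | inj₂ u = ∨-true⁺ʳ {present (recolor g (C ▷ X)) b} (usedColour-▷ˡ C X b u)
usedColour-▷ˡ (join M C C')  X b t with ∨-true⁻ {present (join M C C') b} t
... | inj₁ p = ∨-true⁺ˡ (present-▷ (join M C C') X b p)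
... | inj₂ u with ∨-true⁻ {usedColour C b} u
...   | inj₁ uC  = ∨-true⁺ʳ {present (join M C C' ▷ X) b} (∨-true⁺ˡ (usedColour-▷ˡ C X b uC))
...   | inj₂ uC' = ∨-true⁺ʳ {present (join M C C' ▷ X) b} (∨-true⁺ʳ {usedColour (C ▷ X) b} (usedColour-▷ˡ C' X b uC'))

usedColour-▷ʳ : (C X : CD nR c) → 1 ≤ holes C → (b : Fin c) → usedColour X b ≡ true → usedColour (C ▷ X) b ≡ true
usedColour-▷ʳ (constant a R) X ()
usedColour-▷ʳ hole           X _ b t = t
usedColour-▷ʳ (recolor g C)  X h b t = ∨-true⁺ʳ {present (recolor g (C ▷ X)) b} (usedColour-▷ʳ C X h b t)
usedColour-▷ʳ (join M C C')  X h b t with 1 ≤? holes C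
... | yes hC = ∨-true⁺ʳ {present (join M C C' ▷ X) b} (∨-true⁺ˡ (usedColour-▷ʳ C X hC b t))
... | no ¬hC = ∨-true⁺ʳ {present (join M C C' ▷ X) b} (∨-true⁺ʳ {usedColour (C ▷ X) b}
                 (usedColour-▷ʳ C' X (subst (λ z → 1 ≤ z + holes C') (n≤0⇒n≡0 (≮⇒≥ ¬hC)) h) b t))

UsedIn-▷ˡ : (C X : CD nR c) → UsedIn C (C ▷ X)
UsedIn-▷ˡ C X = usedIn (usedColour-▷ˡ C X)

UsedIn-▷ʳ : (C X : CD nR c) → 1 ≤ holes C → UsedIn X (C ▷ X)
UsedIn-▷ʳ C X h = usedIn (usedColour-▷ʳ C X h)

rank : (p : Fin n → Bool) → Fin n → ℕ
rank p zero    = 0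
rank p (suc a) = (if p zero then 1 else 0) + rank (p ∘ suc) a

rank-injective : (p : Fin n → Bool) {a b : Fin n} → p a ≡ true → p b ≡ true → rank p a ≡ rank p b → a ≡ b
rank-injective p {zero}  {zero}  _  _  _ = refl
rank-injective p {zero}  {suc b} pa _  same with p zero
... | true = ⊥-elim (0≢1+n same)
rank-injective p {suc a} {zero}  _  pb same with p zero
... | true = ⊥-elim (0≢1+n (sym same))
rank-injective p {suc a} {suc b} pa pb same with p zero
... | true  = cong suc (rank-injective (p ∘ suc) pa pb (suc-injective same))
... | false = cong suc (rank-injective (p ∘ suc) pa pb same)

rank<countFin : (p : Fin n → Bool) {a : Fin n} → p a ≡ true → rank p a < countFin n p
rank<countFin p {zero}  pa rewrite pa = s≤s z≤n
rank<countFin p {suc a} pa = +-monoʳ-< (if p zero then 1 else 0) (rank<countFin (p ∘ suc) pa)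

module Compression (p : Fin n → Bool) {k : ℕ} (count≤k : countFin n p ≤ k) where

  compress : (a : Fin n) → p a ≡ true → Fin k
  compress a pa = fromℕ< (<-≤-trans (rank<countFin p pa) count≤k)

  compress-injective : ∀ {a b} (pa : p a ≡ true) (pb : p b ≡ true) → compress a pa ≡ compress b pb → a ≡ b
  compress-injective pa pb same = rank-injective p pa pb (fromℕ<-injective _ _ _ _ same)

module _ {D : CD nR c} {k : ℕ} (wD : width D ≤ k) where
  open Compression (usedColour D) wD

  compressed : (X : CD nR c) → UsedIn X D → CGraph nR k
  compressed X X⊑D = recoloured (cgraphOf X) λ v → compress (colOf X v) (UsedIn.used X⊑D _ (colOf-used X v))

  SameType-uncompress : ∀ m {X Y : CD nR c} (X⊑D : UsedIn X D) (Y⊑D : UsedIn Y D) →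
                        SameType m (compressed X X⊑D) (compressed Y Y⊑D) → SameType m (cgraphOf X) (cgraphOf Y)
  SameType-uncompress m {X} {Y} X⊑D Y⊑D =
    SameType-recolour m (colOf X) (colOf Y)
      (λ v w → compress-injective (UsedIn.used X⊑D _ (colOf-used X v)) (UsedIn.used Y⊑D _ (colOf-used Y w)))

-- Pumping

record Pump (m : ℕ) (D : CD nR c) : Set where
  field
    start loop end : CD nR c
    D≡start▷end    : D ≡ start ▷ end
    loop-invisible : SameType m (cgraphOf (loop ▷ end)) (cgraphOf end)
    holes-start    : holes start ≡ 1
    holes-loop     : holes loop ≡ 1
    loop-nonempty  : 1 ≤ ∣ loop ∣
    start⊑D        : UsedIn start D
    loop⊑D         : UsedIn loop D
    end⊑D          : UsedIn end D

module Chain {D : CD nR c} (Cs : List (CD nR c)) (B : CD nR c)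
             (nonempty : All NonemptyContext Cs) (D≡glue : D ≡ glue Cs B) where

  oneHole : All (λ C → holes C ≡ 1) Cs
  oneHole = All.map proj₁ nonempty

  suffix prefix : ℕ → CD nR c
  suffix i = glue (drop i Cs) B
  prefix i = context (take i Cs)

  holes-prefix : ∀ i → holes (prefix i) ≡ 1
  holes-prefix i = holes-context (take⁺ i oneHole)

  D≡prefix▷suffix : ∀ i → D ≡ prefix i ▷ suffix i
  D≡prefix▷suffix i = trans D≡glue (glue-drop 0 i Cs B)

  suffix⊑D : ∀ i → UsedIn (suffix i) D
  suffix⊑D i =
    UsedIn-trans (UsedIn-▷ʳ (prefix i) (suffix i) (≤-reflexive (sym (holes-prefix i)))) (UsedIn-≡ (sym (D≡prefix▷suffix i)))

  collision : ∀ m {k N} → IsTypeCount nR k m N → width D ≤ k → length Cs ≡ N →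
              Σ ℕ λ i → Σ ℕ λ j → i < j × j ≤ length Cs × SameType m (cgraphOf (suffix i)) (cgraphOf (suffix j))
  collision m {k} {N} (rep , _ , classify) wD len =
    let fi , fj , i<j , sameIndex = pigeonhole (n<1+n N) typeOf in
    toℕ fi , toℕ fj , i<j , subst (toℕ fj ≤_) (sym len) (≤-pred (toℕ<n fj)) ,
    SameType-uncompress {D = D} wD m {suffix (toℕ fi)} {suffix (toℕ fj)} (suffix⊑D (toℕ fi)) (suffix⊑D (toℕ fj))
      (SameType-trans m {compressedAt fi} {rep (typeOf fi)} {compressedAt fj} (proj₂ (classify (compressedAt fi)))
        (subst (λ t → SameType m (rep t) (compressedAt fj)) (sym sameIndex)
          (SameType-sym m (proj₂ (classify (compressedAt fj))))))
    where
    compressedAt : Fin (suc N) → CGraph nR k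
    compressedAt i = compressed {D = D} wD (suffix (toℕ i)) (suffix⊑D (toℕ i))
    typeOf : Fin (suc N) → Fin N
    typeOf i = proj₁ (classify (compressedAt i))

  pump-between : ∀ m i o → i + suc o ≤ length Cs →
                 SameType m (cgraphOf (suffix i)) (cgraphOf (suffix (i + suc o))) → Pump m D
  pump-between m i o bound sameType = record
    { start          = prefix j
    ; loop           = loop
    ; end            = suffix j
    ; D≡start▷end    = D≡prefix▷suffix j
    ; loop-invisible = subst (λ X → SameType m (cgraphOf X) (cgraphOf (suffix j))) suffixᵢ≡loop▷suffixⱼ sameType
    ; holes-start    = holes-prefix j
    ; holes-loop     = holes-context (take⁺ (suc o) (drop⁺ i oneHole))
    ; loop-nonempty  = context-nonempty o (drop⁺ i nonempty)
                         (subst (0 <_) (sym (length-drop i Cs)) (m<n⇒0<n∸m (<-≤-trans (m<m+n i (s≤s z≤n)) bound)))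
    ; start⊑D        = UsedIn-trans (UsedIn-▷ˡ (prefix j) (suffix j)) (UsedIn-≡ (sym (D≡prefix▷suffix j)))
    ; loop⊑D         = UsedIn-trans (UsedIn-▷ˡ loop (suffix j))
                         (UsedIn-trans (UsedIn-≡ (sym suffixᵢ≡loop▷suffixⱼ)) (suffix⊑D i))
    ; end⊑D          = suffix⊑D j
    }
    where
    j : ℕ
    j = i + suc o
    loop : CD nR c
    loop = context (take (suc o) (drop i Cs))
    suffixᵢ≡loop▷suffixⱼ : suffix i ≡ loop ▷ suffix j
    suffixᵢ≡loop▷suffixⱼ = glue-drop i (suc o) Cs B

pump : ∀ m {k N} → IsTypeCount nR k m N → (D : CD nR c) → holes D ≡ 0 → width D ≤ k → 2 ^ N < ∣ D ∣ → Pump m D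
pump m {N = N} types D hD wD big =
  let Cs , B , len , nonempty , D≡glue = chain N D hD big
      open Chain Cs B nonempty D≡glue
      i , j , i<j , j≤len , sameType = collision m types wD len
      o , i+1+o≡j = m≤n⇒∃[o]m+o≡n i<j
      i+[1+o]≡j = trans (+-suc i o) i+1+o≡j
  in pump-between m i o (subst (_≤ length Cs) (sym i+[1+o]≡j) j≤len)
       (subst (λ t → SameType m (cgraphOf (suffix i)) (cgraphOf (suffix t))) (sym i+[1+o]≡j) sameType)

pumped : ℕ → CD nR c → CD nR c → CD nR c
pumped zero    C X = X
pumped (suc ℓ) C X = C ▷ pumped ℓ C X

SameType-pumped : ∀ m {C X : CD nR c} → SameType m (cgraphOf (C ▷ X)) (cgraphOf X) →
                  ∀ ℓ → SameType m (cgraphOf (pumped ℓ C X)) (cgraphOf X)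
SameType-pumped m invisible zero    ψ k = refl
SameType-pumped m {C} invisible (suc ℓ) = SameType-trans m (SameType-▷ m C (SameType-pumped m invisible ℓ)) invisible

Δ-pumped : (Cs Cr Ce X : CD nR c) → ∀ ℓ →
           foldl (λ Y i → Y ▷ family Cs Cr Ce i) X (replicate ℓ r ++ e ∷ []) ≡ X ▷ pumped ℓ Cr Ce
Δ-pumped Cs Cr Ce X zero    = refl
Δ-pumped Cs Cr Ce X (suc ℓ) = trans (Δ-pumped Cs Cr Ce (X ▷ Cr) ℓ) (▷-assoc X Cr (pumped ℓ Cr Ce))

module _ {m : ℕ} {D : CD nR c} (P : Pump m D) where
  open Pump P

  holes-end : holes D ≡ 0 → holes end ≡ 0
  holes-end hD = begin
    holes end                 ≡⟨ *-identityˡ (holes end) ⟨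
    1 * holes end             ≡⟨ cong (_* holes end) holes-start ⟨
    holes start * holes end   ≡⟨ holes-▷ start end ⟨
    holes (start ▷ end)       ≡⟨ cong holes D≡start▷end ⟨
    holes D                   ≡⟨ hD ⟩
    0                         ∎
    where open ≡-Reasoning

  SameType-Δ : ∀ ℓ → SameType m (cgraphOf D) (cgraphOf (Δ (family start loop end) s (replicate ℓ r ++ e ∷ [])))
  SameType-Δ ℓ rewrite Δ-pumped start loop end start ℓ | D≡start▷end =
    SameType-▷ m start (SameType-sym m (SameType-pumped m loop-invisible ℓ))

lemma14 : (nR : ℕ) (φ : Formula nR 0 0 0) (m k N x : ℕ) →
    qr φ ≡ m → IsTypeCount nR k m N →
    (G : Graph nR) → G ⊨ φ → CliqueWidth≤ k G → vert G ≡ x → 2 ^ N < x →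
    Σ ℕ λ c → Σ (CD nR c) λ Cs → Σ (CD nR c) λ Cr → Σ (CD nR c) λ Ce →
      holes Cs ≡ 1 × holes Cr ≡ 1 × holes Ce ≡ 0 ×
      width Cs ≤ k × width Cr ≤ k × width Ce ≤ k ×
      ((ℓ : ℕ) → graphOf (Δ (family Cs Cr Ce) s (replicate ℓ r ++ e ∷ [])) ⊨ φ) ×
      ∣ Cs ▷ Ce ∣ ≡ x × 1 ≤ ∣ Cr ∣
lemma14 nR φ m k N x qrφ types G Gφ (c , D , hD , wD , D≅G) ∣G∣≡x big =
  c , start , loop , end ,
  holes-start , holes-loop , holes-end P hD ,
  ≤-trans (width-mono start⊑D) wD , ≤-trans (width-mono loop⊑D) wD , ≤-trans (width-mono end⊑D) wD ,
  (λ ℓ → ⊨-transfer m φ (≤-reflexive qrφ) (SameType-Δ P ℓ) (⊨-iso φ D≅G Gφ)) ,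
  trans (cong ∣_∣ (sym D≡start▷end)) ∣D∣≡x , loop-nonempty
  where
  ∣D∣≡x : ∣ D ∣ ≡ x
  ∣D∣≡x = trans (↔⇒≡ (proj₁ D≅G)) ∣G∣≡x
  P : Pump m D
  P = pump m types D hD wD (subst (2 ^ N <_) (sym ∣D∣≡x) big)
  open Pump P
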